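{- Let $m\geqslant 2$, $n\geqslant 1$. If a $T$-torsion $(n+1)$-flag class $[\mathcal{V}']$ in $S^m$ corresponds to the conjugacy class $[N']$ of nilpotent upper-triangular $(n+1)\times(n+1)$ matrices (i.e. $N'$ is the matrix of $T$ with respect to an ordered basis of a representative of $[\mathcal{V}']$), then the matrix degree of $[\mathcal{V}']$ equals the matrix degree of $[N']$.
   Context: $A=\mathbb{F}_q[T]$, $S^1=\mathbb{F}_q[1/T]/\mathbb{F}_q$ as an $A$-module, $S^m=(S^1)^{\oplus m}$. An $n$-flag in $S^m$ is a chain $V_1\subset\cdots\subset V_n$ of $\mathbb{F}_q$-subspaces with $\dim V_i=i$; an ordered basis is a basis $(\nu_1,\dots,\nu_n)$ of $V_n$ with $V_i=\mathrm{span}(\nu_1,\dots,\nu_i)$. A $T$-torsion $n$-flag: $TV_1=0$, $TV_i\subseteq V_{i-1}$. Isomorphism of $T$-torsion $n$-flags: $\mathbb{F}_q$-linear isomorphism $V_n\to W_n$ mapping $V_i$ onto $W_i$ and commuting with $T$; classes $[\mathcal{V}]$ are isomorphism classes. A child of $\mathcal{V}=(V_1\subset\cdots\subset V_n)$ is a $T$-torsion $(n+1)$-flag $(V_1\subset\cdots\subset V_n\subset V_{n+1})$; the parent class of $[\mathcal{V}']$ is the class of the parent of a representative. The matrix $N$ of $T$ on an ordered basis is defined by $T(\nu_1,\dots,\nu_n)=(\nu_1,\dots,\nu_n)N$; its conjugacy class under invertible upper-triangular matrices depends only on $[\mathcal{V}]$. Matrix degree of a flag class: let $[\mathcal{V}']$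 be a $T$-torsion $(n+1)$-flag class with parent class $[\mathcal{V}]$, and fix a representative $\mathcal{V}=(V_1\subset\cdots\subset V_n)$ of $[\mathcal{V}]$. Let $M(\mathcal{V};[\mathcal{V}'])$ be the set of $\nu\in S^m\setminus V_n$ with $T\nu\in V_n$ such that $(V_1\subset\cdots\subset V_n\subset V_n\oplus\mathbb{F}_q\nu)$ represents $[\mathcal{V}']$. Call $\nu,\tilde\nu$ equivalent if $T(\nu-k\tilde\nu)\in TV_n$ for some $k\in\mathbb{F}_q^*$. The matrix degree of $[\mathcal{V}']$ is the number of equivalence classes. Matrix degree of a conjugacy class: for a conjugacy $(n+1)$-class $[N']$ of nilpotent upper-triangular matrices with parent class $[N]$ ($N$ the top-left $n\times n$ block of $N'$), let $B(N;[N'])=\{\begin{pmatrix}N&b\\0&0\end{pmatrix}: b\in\mathbb{F}_q^{n\times1}\}\cap[N']$; its matrix degree is the number of orbits of conjugation on $B(N;[N'])$ by the group of matrices $\begin{pmatrix}I_n&b\\0&k\end{pmatrix}$, $b\in\mathbb{F}_q^{n\times1}$, $k\in\mathbb{F}_q^*$. -}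

module Defs where

open import Level using (0ℓ)
open import Algebra.Bundles using (CommutativeRing)
open import Data.Nat using (ℕ; zero; suc; _≤_; _<_)
open import Data.Fin using (Fin; zero; suc; toℕ; _≟_)
open import Data.Maybe using (Maybe; just; nothing)
import Data.Maybe as Maybe
open import Data.List using (List; []; _∷_; map)
open import Data.List.Relation.Unary.Any using (Any)
open import Data.Product using (Σ; ∃; _×_)
open import Data.Vec.Functional using (Vector)
open import Relation.Nullary using (¬_; does)
open import Relation.Binary.Definitions using (Decidable)
open import Relation.Binary.PropositionalEquality using (_≡_)
open import Data.Bool using (if_then_else_)

record FiniteField : Set₁ where
  field
    commRing : CommutativeRing 0ℓ 0ℓ
  open CommutativeRing commRing public
  field
    0≉1      : ¬ (0# ≈ 1#)
    inverse  : ∀ x → ¬ (x ≈ 0#) → ∃ λ y → x * y ≈ 1#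
    decEq    : Decidable _≈_
    elements : List Carrier
    complete : ∀ x → Any (x ≈_) elements

fsplit : ∀ {n} → Fin (suc n) → Maybe (Fin n)
fsplit {zero}  zero    = nothing
fsplit {suc n} zero    = just zero
fsplit {suc n} (suc i) = Maybe.map suc (fsplit i)

-- Number of equivalence classes: `HasClasses P R k` says that the
-- relation R on the set {a | P a} has exactly k classes (a complete
-- system of k pairwise inequivalent representatives).

HasClasses : {A : Set} → (A → Set) → (A → A → Set) → ℕ → Set
HasClasses {A} P R k =
  Σ (Fin k → A) λ r →
    (∀ i → P (r i)) ×
    (∀ i j → R (r i) (r j) → i ≡ j) ×
    (∀ a → P a → ∃ λ i → R a (r i))

module Over (𝔽 : FiniteField) where
  open FiniteField 𝔽 using (Carrier; _≈_; _+_; _*_; -_; 0#; 1#)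

  -- S^m = (F_q[1/T]/F_q)^m.  An element is the list of its coefficient
  -- vectors (in F_q^m) of T^{-1}, T^{-2}, ... ; T acts by multiplication
  -- by T, which kills the T^{-1} term (it becomes a constant) and shifts.

  SElt : ℕ → Set
  SElt m = List (Fin m → Carrier)

  coeff : ∀ {m} → SElt m → ℕ → Fin m → Carrier
  coeff []       _       _ = 0#
  coeff (x ∷ xs) zero    i = x i
  coeff (x ∷ xs) (suc j) i = coeff xs j i

  _≈ₛ_ : ∀ {m} → SElt m → SElt m → Set
  x ≈ₛ y = ∀ j i → coeff x j i ≈ coeff y j i

  0ₛ : ∀ {m} → SElt m
  0ₛ = []

  _⊕_ : ∀ {m} → SElt m → SElt m → SElt m
  []       ⊕ ys       = ys
  (x ∷ xs) ⊕ []       = x ∷ xs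
  (x ∷ xs) ⊕ (y ∷ ys) = (λ i → x i + y i) ∷ (xs ⊕ ys)

  _·ₛ_ : ∀ {m} → Carrier → SElt m → SElt m
  k ·ₛ xs = map (λ x i → k * x i) xs

  Tₛ : ∀ {m} → SElt m → SElt m
  Tₛ []       = []
  Tₛ (x ∷ xs) = xs

  lin : ∀ {m n} → (Fin n → Carrier) → (Fin n → SElt m) → SElt m
  lin {n = zero}  c ν = 0ₛ
  lin {n = suc n} c ν = (c zero ·ₛ ν zero) ⊕ lin (λ j → c (suc j)) (λ j → ν (suc j))

  -- Flags, given by an ordered basis ν = (ν_1,…,ν_n);  V_i = span(ν_1..ν_i).

  SuppBelow : ∀ {n} → ℕ → (Fin n → Carrier) → Set
  SuppBelow i c = ∀ j → i ≤ toℕ j → c j ≈ 0#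

  InSpan : ∀ {m n} → ℕ → (Fin n → SElt m) → SElt m → Set
  InSpan i ν x = ∃ λ c → SuppBelow i c × (x ≈ₛ lin c ν)

  IsFlag : ∀ {m n} → (Fin n → SElt m) → Set
  IsFlag ν = ∀ c → lin c ν ≈ₛ 0ₛ → ∀ j → c j ≈ 0#

  IsTorsion : ∀ {m n} → (Fin n → SElt m) → Set
  IsTorsion {n = n} ν = ∀ i → i < n → ∀ x → InSpan (suc i) ν x → InSpan i ν (Tₛ x)

  IsTorsionFlag : ∀ {m n} → (Fin n → SElt m) → Set
  IsTorsionFlag ν = IsFlag ν × IsTorsion ν

  -- φ : V_n → W_n, the F_q-linear map sending ν_j ↦ f_j, is an
  -- isomorphism of flags (maps V_i onto W_i, is injective) commuting with T.
  IsoVia : ∀ {m n} → (ν w f : Fin n → SElt m) → Set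
  IsoVia ν w f =
    (∀ i c → SuppBelow i c → InSpan i w (lin c f)) ×
    (∀ i x → InSpan i w x → ∃ λ c → SuppBelow i c × (lin c f ≈ₛ x)) ×
    (∀ c → lin c f ≈ₛ 0ₛ → lin c ν ≈ₛ 0ₛ) ×
    (∀ c d → Tₛ (lin c ν) ≈ₛ lin d ν → Tₛ (lin c f) ≈ₛ lin d f)

  Iso : ∀ {m n} → (ν w : Fin n → SElt m) → Set
  Iso ν w = ∃ λ f → IsoVia ν w f

  parent : ∀ {m n} → (Fin (suc n) → SElt m) → Fin n → SElt m
  parent ν i = ν (Data.Fin.inject₁ i)

  snoc : ∀ {m n} → (Fin n → SElt m) → SElt m → Fin (suc n) → SElt m
  snoc ν x i with fsplit i
  ... | just j  = ν j
  ... | nothing = x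

  -- M(V;[V']) for V given by basis ν, [V'] the class of the flag with basis ν'
  MSet : ∀ {m n} → (Fin n → SElt m) → (Fin (suc n) → SElt m) → SElt m → Set
  MSet {n = n} ν ν' x =
    ¬ InSpan n ν x × InSpan n ν (Tₛ x) × Iso (snoc ν x) ν'

  MEquiv : ∀ {m n} → (Fin n → SElt m) → SElt m → SElt m → Set
  MEquiv ν x y =
    ∃ λ k → ¬ (k ≈ 0#) × ∃ λ c → Tₛ (x ⊕ ((- k) ·ₛ y)) ≈ₛ Tₛ (lin c ν)

  Mat : ℕ → ℕ → Set
  Mat a b = Fin a → Fin b → Carrier

  sumF : ∀ {n} → (Fin n → Carrier) → Carrier
  sumF {zero}  f = 0#
  sumF {suc n} f = f zero + sumF (λ j → f (suc j))

  _⊗_ : ∀ {a b c} → Mat a b → Mat b c → Mat a c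
  (X ⊗ Y) i k = sumF (λ j → X i j * Y j k)

  _≈ₘ_ : ∀ {a b} → Mat a b → Mat a b → Set
  X ≈ₘ Y = ∀ i j → X i j ≈ Y i j

  I : ∀ {n} → Mat n n
  I i j = if does (i ≟ j) then 1# else 0#

  UpperTriangular : ∀ {n} → Mat n n → Set
  UpperTriangular P = ∀ i j → toℕ j < toℕ i → P i j ≈ 0#

  InConjClass : ∀ {n} → Mat n n → Mat n n → Set
  InConjClass X Y =
    ∃ λ P → ∃ λ Q → UpperTriangular P × ((P ⊗ Q) ≈ₘ I) × ((Q ⊗ P) ≈ₘ I)
      × (X ≈ₘ ((P ⊗ Y) ⊗ Q))

  IsMatrixOfT : ∀ {m n} → (Fin n → SElt m) → Mat n n → Set
  IsMatrixOfT ν N = ∀ j → Tₛ (ν j) ≈ₛ lin (λ i → N i j) ν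

  topLeft : ∀ {n} → Mat (suc n) (suc n) → Mat n n
  topLeft N i j = N (Data.Fin.inject₁ i) (Data.Fin.inject₁ j)

  block : ∀ {n} → Mat n n → (Fin n → Carrier) → Carrier → Mat (suc n) (suc n)
  block X b k i j with fsplit i | fsplit j
  ... | just i′ | just j′  = X i′ j′
  ... | just i′ | nothing  = b i′
  ... | nothing | just _   = 0#
  ... | nothing | nothing  = k

  -- B(N;[N']) : the matrices (N b; 0 0) lying in [N'], indexed by b
  BSet : ∀ {n} → Mat n n → Mat (suc n) (suc n) → (Fin n → Carrier) → Set
  BSet N N' b = InConjClass (block N b 0#) N'

  BOrbit : ∀ {n} → Mat n n → (Fin n → Carrier) → (Fin n → Carrier) → Set
  BOrbit N b b′ =
    ∃ λ c → ∃ λ k → ¬ (k ≈ 0#) × ∃ λ H →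
      ((block I c k ⊗ H) ≈ₘ I) × ((H ⊗ block I c k) ≈ₘ I) ×
      (((block I c k ⊗ block N b 0#) ⊗ H) ≈ₘ block N b′ 0#)

-- Write V for the flag with basis ν, N for the matrix of T on it, and V′ for the class of the child flag.
-- For x ∈ M(V;[V′]) let d be the coordinates of T x in ν; the child V ⊕ 𝔽 x then has the matrix ( N d ; 0 0 ).
-- Two flags are isomorphic exactly when their matrices are conjugate by invertible upper triangular matrices,
-- so x ↦ d, transported to the parent of V′ by the change of basis V ≅ parent V′, lands in B(N;[N′]). Both
-- equivalences become "d − k d′ ∈ im N for some k ≠ 0": for M because V is T-stable, for B because that is what
-- conjugation by ( I c ; 0 k ) does to the last column. Every d with ( N d ; 0 0 ) ∈ [N′] is realised by some
-- x ∉ V with T x = ∑ d_i ν_i: otherwise V would contain all of the m-dimensional kernel of T together with such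
-- a preimage, giving m + 1 independent vectors killed by ( N d ; 0 0 ), hence by N′, which no flag in S^m carries.

module Submission where

open import Defs
open import Level using (0ℓ)
import Algebra.Properties.CommutativeSemigroup as CommSemigroupProperties
import Algebra.Properties.Ring as RingProperties
import Algebra.Properties.Semiring.Sum as SumProperties
open import Data.Empty using (⊥; ⊥-elim)
open import Data.Fin using (Fin; zero; suc; toℕ; inject₁; fromℕ; _≟_; punchIn)
import Data.Fin.Properties as Finₚ
open import Data.List using (List; []; _∷_; cartesianProductWith)
import Data.List.Relation.Unary.Any as Any
open import Data.List.Relation.Unary.Any.Properties using (cartesianProductWith⁺)
open import Data.Maybe using (just; nothing)
import Data.Maybe as Maybe
open import Data.Nat using (ℕ; zero; suc; _≤_; _<_; _∸_; _≤?_; _<?_)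
import Data.Nat.Properties as ℕₚ
open import Data.Product using (Σ; ∃; _×_; _,_; proj₁; proj₂)
open import Data.Sum using (_⊎_; inj₁; inj₂)
open import Data.Vec.Functional using (Vector; insertAt; tail)
import Data.Vec.Functional as Vector
open import Data.Vec.Functional.Properties using (insertAt-lookup; insertAt-punchIn)
import Data.Vec.Functional.Relation.Binary.Equality.Setoid as PointwiseEquality
open import Function.Base using (_∘_)
open import Function.Bundles using (_⇔_; mk⇔; Equivalence)
open import Relation.Binary.Bundles using (Setoid)
open import Relation.Binary.Definitions using (_Respects₂_)
open import Relation.Binary.PropositionalEquality as ≡ using (_≡_; _≢_)
import Relation.Binary.Reasoning.Setoid as SetoidReasoning
open import Relation.Nullary using (¬_; Dec; yes; no; ¬?)
open import Relation.Nullary.Decidable using (decidable-stable)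

-- φ may use the membership proof, and only has to be surjective onto Q up to the setoid equality
HasClasses-transfer : ∀ {A : Set} {P : A → Set} {R : A → A → Set} (B : Setoid 0ℓ 0ℓ)
  {Q : Setoid.Carrier B → Set} {S : Setoid.Carrier B → Setoid.Carrier B → Set} → S Respects₂ Setoid._≈_ B →
  (φ : ∀ a → P a → Setoid.Carrier B) → (∀ a p → Q (φ a p)) →
  (∀ b → Q b → Σ A λ a → Σ (P a) λ p → Setoid._≈_ B (φ a p) b) →
  (∀ {a a′} (p : P a) (p′ : P a′) → R a a′ ⇔ S (φ a p) (φ a′ p′)) →
  ∀ k → HasClasses P R k ⇔ HasClasses Q S k
HasClasses-transfer {P = P} {R} B {Q} {S} (S-respʳ , S-respˡ) φ φ-in lift φ-equiv k = mk⇔ to from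
  where
  open Setoid B using (sym)
  to : HasClasses P R k → HasClasses Q S k
  to (r , r∈P , r-distinct , r-cover) =
    (λ i → φ (r i) (r∈P i)) , (λ i → φ-in (r i) (r∈P i)) ,
    (λ i j related → r-distinct i j (Equivalence.from (φ-equiv (r∈P i) (r∈P j)) related)) ,
    λ b b∈Q → let (a , a∈P , φa≈b) = lift b b∈Q
                  (i , a~rᵢ) = r-cover a a∈P
              in i , S-respˡ φa≈b (Equivalence.to (φ-equiv a∈P (r∈P i)) a~rᵢ)
  from : HasClasses Q S k → HasClasses P R k
  from (r , r∈Q , r-distinct , r-cover) =
    (λ i → proj₁ (lifted i)) , (λ i → proj₁ (proj₂ (lifted i))) ,
    (λ i j related → r-distinct i j
      (S-respʳ (proj₂ (proj₂ (lifted j)))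
        (S-respˡ (proj₂ (proj₂ (lifted i))) (Equivalence.to (φ-equiv _ _) related)))) ,
    λ a a∈P → let (i , φa~rᵢ) = r-cover (φ a a∈P) (φ-in a a∈P)
              in i , Equivalence.from (φ-equiv a∈P _) (S-respʳ (sym (proj₂ (proj₂ (lifted i)))) φa~rᵢ)
    where
    lifted = λ i → lift (r i) (r∈Q i)

module _ (𝔽 : FiniteField) where

  open FiniteField 𝔽 hiding (zero)
  open Over 𝔽
  open RingProperties ring
  open SumProperties semiring
    using (sum; sum-cong-≋; sum-init-last; sum-remove; ∑-distrib-+; ∑-comm; *-distribˡ-sum; *-distribʳ-sum;
           sum-replicate-zero)
  open CommSemigroupProperties *-commutativeSemigroup using () renaming (x∙yz≈y∙xz to x*[y*z]≈y*[x*z])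
  open PointwiseEquality setoid using (_≋_; ≋-refl; ≋-sym; ≋-setoid)

  Col : ℕ → Set
  Col = Vector Carrier

  0ᶜ : ∀ {n} → Col n
  0ᶜ _ = 0#

  -- sumF is the library's sum only up to propositional equality, which transports its lemmas
  sumF≡sum : ∀ {n} (f : Col n) → sumF f ≡ sum f
  sumF≡sum {zero}  f = ≡.refl
  sumF≡sum {suc n} f = ≡.cong (f zero +_) (sumF≡sum (f ∘ suc))

  via-sum : ∀ {m n} {f : Col m} {g : Col n} → sum f ≈ sum g → sumF f ≈ sumF g
  via-sum {f = f} {g} e = trans (reflexive (sumF≡sum f)) (trans e (reflexive (≡.sym (sumF≡sum g))))

  sumF-cong : ∀ {n} {f g : Col n} → f ≋ g → sumF f ≈ sumF g
  sumF-cong {f = f} {g} f≋g = via-sum {f = f} {g} (sum-cong-≋ {x = f} {g} f≋g)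

  sumF-zero : ∀ {n} {f : Col n} → f ≋ 0ᶜ → sumF f ≈ 0#
  sumF-zero {n} f≋0 = trans (sumF-cong f≋0) (trans (reflexive (sumF≡sum {n} 0ᶜ)) (sum-replicate-zero n))

  sumF-distrib-+ : ∀ {n} (f g : Col n) → sumF (λ i → f i + g i) ≈ sumF f + sumF g
  sumF-distrib-+ f g = trans (reflexive (sumF≡sum (λ i → f i + g i)))
    (trans (∑-distrib-+ f g) (sym (+-cong (reflexive (sumF≡sum f)) (reflexive (sumF≡sum g)))))

  *-distribˡ-sumF : ∀ {n} k (f : Col n) → k * sumF f ≈ sumF (λ i → k * f i)
  *-distribˡ-sumF k f = trans (*-congˡ (reflexive (sumF≡sum f)))
    (trans (*-distribˡ-sum k f) (reflexive (≡.sym (sumF≡sum (λ i → k * f i)))))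

  *-distribʳ-sumF : ∀ {n} k (f : Col n) → sumF f * k ≈ sumF (λ i → f i * k)
  *-distribʳ-sumF k f = trans (*-congʳ (reflexive (sumF≡sum f)))
    (trans (*-distribʳ-sum k f) (reflexive (≡.sym (sumF≡sum (λ i → f i * k)))))

  sumF-comm : ∀ {p q} (G : Fin p → Fin q → Carrier) →
    sumF (λ i → sumF (λ j → G i j)) ≈ sumF (λ j → sumF (λ i → G i j))
  sumF-comm G = trans (sumF-cong (λ i → reflexive (sumF≡sum (G i))))
    (trans (via-sum {f = λ i → sum (G i)} {λ j → sum (λ i → G i j)} (∑-comm G))
           (sumF-cong (λ j → reflexive (≡.sym (sumF≡sum (λ i → G i j))))))

  sumF-init-last : ∀ {n} (f : Col (suc n)) → sumF f ≈ sumF (f ∘ inject₁) + f (fromℕ n)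
  sumF-init-last f = trans (reflexive (sumF≡sum f))
    (trans (sum-init-last f) (+-congʳ (reflexive (≡.sym (sumF≡sum (f ∘ inject₁))))))

  sumF-remove : ∀ {n} (f : Col (suc n)) i → sumF f ≈ f i + sumF (f ∘ punchIn i)
  sumF-remove f i = trans (reflexive (sumF≡sum f))
    (trans (sum-remove {i = i} f) (+-congˡ (reflexive (≡.sym (sumF≡sum (f ∘ punchIn i))))))

  sumF-δ : ∀ {n} (f : Col n) i → (∀ j → j ≢ i → f j ≈ 0#) → sumF f ≈ f i
  sumF-δ {suc _} f i f≈0 = trans (sumF-remove f i)
    (trans (+-congˡ (sumF-zero (λ j → f≈0 _ (Finₚ.punchInᵢ≢i i j)))) (+-identityʳ (f i)))

  sumF-neg : ∀ {n} (f : Col n) → sumF (λ i → - f i) ≈ - sumF f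
  sumF-neg f = begin
    sumF (λ i → - f i)        ≈⟨ sumF-cong (λ i → -1*x≈-x (f i)) ⟨
    sumF (λ i → - 1# * f i)   ≈⟨ *-distribˡ-sumF (- 1#) f ⟨
    - 1# * sumF f             ≈⟨ -1*x≈-x (sumF f) ⟩
    - sumF f                  ∎
    where open SetoidReasoning setoid

  col : ∀ {a b} → Mat a b → Fin b → Col a
  col A j i = A i j

  unit : ∀ {n} → Fin n → Col n
  unit = col I

  infixr 7 _⊗ᵥ_
  _⊗ᵥ_ : ∀ {a b} → Mat a b → Col b → Col a
  (A ⊗ᵥ v) i = sumF (λ j → A i j * v j)

  I-diag : ∀ {n} (i : Fin n) → I i i ≈ 1#
  I-diag i with i ≟ i
  ... | yes _  = refl
  ... | no i≢i = ⊥-elim (i≢i ≡.refl)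

  I-off : ∀ {n} {i j : Fin n} → i ≢ j → I i j ≈ 0#
  I-off {i = i} {j} i≢j with i ≟ j
  ... | yes i≡j = ⊥-elim (i≢j i≡j)
  ... | no _    = refl

  ⊗ᵥ-cong : ∀ {a b} {A B : Mat a b} {u v : Col b} → A ≈ₘ B → u ≋ v → A ⊗ᵥ u ≋ B ⊗ᵥ v
  ⊗ᵥ-cong A≈B u≋v i = sumF-cong (λ j → *-cong (A≈B i j) (u≋v j))

  ⊗ᵥ-congʳ : ∀ {a b} (A : Mat a b) {u v : Col b} → u ≋ v → A ⊗ᵥ u ≋ A ⊗ᵥ v
  ⊗ᵥ-congʳ A = ⊗ᵥ-cong {A = A} (λ _ _ → refl)

  ⊗ᵥ-assoc : ∀ {a b c} (A : Mat a b) (B : Mat b c) (v : Col c) →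
    (A ⊗ B) ⊗ᵥ v ≋ A ⊗ᵥ (B ⊗ᵥ v)
  ⊗ᵥ-assoc A B v i = begin
    sumF (λ l → sumF (λ j → A i j * B j l) * v l)
      ≈⟨ sumF-cong (λ l → *-distribʳ-sumF (v l) (λ j → A i j * B j l)) ⟩
    sumF (λ l → sumF (λ j → (A i j * B j l) * v l))
      ≈⟨ sumF-comm (λ l j → (A i j * B j l) * v l) ⟩
    sumF (λ j → sumF (λ l → (A i j * B j l) * v l))
      ≈⟨ sumF-cong (λ j → sumF-cong (λ l → *-assoc (A i j) (B j l) (v l))) ⟩
    sumF (λ j → sumF (λ l → A i j * (B j l * v l)))
      ≈⟨ sumF-cong (λ j → *-distribˡ-sumF (A i j) (λ l → B j l * v l)) ⟨
    sumF (λ j → A i j * sumF (λ l → B j l * v l))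
      ∎
    where open SetoidReasoning setoid

  ⊗ᵥ-distrib-+ : ∀ {a b} (A : Mat a b) (u v : Col b) →
    A ⊗ᵥ (λ j → u j + v j) ≋ (λ i → (A ⊗ᵥ u) i + (A ⊗ᵥ v) i)
  ⊗ᵥ-distrib-+ A u v i =
    trans (sumF-cong (λ j → distribˡ (A i j) (u j) (v j)))
          (sumF-distrib-+ (λ j → A i j * u j) (λ j → A i j * v j))

  ⊗ᵥ-* : ∀ {a b} (A : Mat a b) k (v : Col b) → A ⊗ᵥ (λ j → k * v j) ≋ (λ i → k * (A ⊗ᵥ v) i)
  ⊗ᵥ-* A k v i =
    trans (sumF-cong (λ j → x*[y*z]≈y*[x*z] (A i j) k (v j))) (sym (*-distribˡ-sumF k (λ j → A i j * v j)))

  ⊗ᵥ-zeroʳ : ∀ {a b} (A : Mat a b) → A ⊗ᵥ 0ᶜ ≋ 0ᶜ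
  ⊗ᵥ-zeroʳ A i = sumF-zero (λ j → zeroʳ (A i j))

  ⊗ᵥ-identityˡ : ∀ {n} (v : Col n) → I ⊗ᵥ v ≋ v
  ⊗ᵥ-identityˡ v i =
    trans (sumF-δ (λ j → I i j * v j) i (λ j j≢i → trans (*-congʳ (I-off (j≢i ∘ ≡.sym))) (zeroˡ (v j))))
          (trans (*-congʳ (I-diag i)) (*-identityˡ (v i)))

  ⊗ᵥ-unit : ∀ {a b} (A : Mat a b) j → A ⊗ᵥ unit j ≋ col A j
  ⊗ᵥ-unit A j i =
    trans (sumF-δ (λ l → A i l * I l j) j (λ l l≢j → trans (*-congˡ (I-off l≢j)) (zeroʳ (A i l))))
          (trans (*-congˡ (I-diag j)) (*-identityʳ (A i j)))

  ≈ₘ-setoid : ℕ → ℕ → Setoid _ _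
  ≈ₘ-setoid a b = record
    { Carrier = Mat a b ; _≈_ = _≈ₘ_
    ; isEquivalence = record
      { refl = λ _ _ → refl ; sym = λ e i j → sym (e i j) ; trans = λ e f i j → trans (e i j) (f i j) } }

  module ≈ₘ {a b} = Setoid (≈ₘ-setoid a b)

  ⊗-cong : ∀ {a b c} {A A′ : Mat a b} {B B′ : Mat b c} → A ≈ₘ A′ → B ≈ₘ B′ → (A ⊗ B) ≈ₘ (A′ ⊗ B′)
  ⊗-cong A≈A′ B≈B′ i k = ⊗ᵥ-cong A≈A′ (λ j → B≈B′ j k) i

  ⊗-congʳ : ∀ {a b c} {A A′ : Mat a b} (B : Mat b c) → A ≈ₘ A′ → (A ⊗ B) ≈ₘ (A′ ⊗ B)
  ⊗-congʳ B A≈A′ = ⊗-cong A≈A′ (≈ₘ.refl {x = B})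

  ⊗-congˡ : ∀ {a b c} (A : Mat a b) {B B′ : Mat b c} → B ≈ₘ B′ → (A ⊗ B) ≈ₘ (A ⊗ B′)
  ⊗-congˡ A = ⊗-cong (≈ₘ.refl {x = A})

  ⊗-assoc : ∀ {a b c d} (A : Mat a b) (B : Mat b c) (C : Mat c d) → ((A ⊗ B) ⊗ C) ≈ₘ (A ⊗ (B ⊗ C))
  ⊗-assoc A B C i k = ⊗ᵥ-assoc A B (col C k) i

  ⊗-identityˡ : ∀ {a b} (A : Mat a b) → (I ⊗ A) ≈ₘ A
  ⊗-identityˡ A i k = ⊗ᵥ-identityˡ (col A k) i

  ⊗-identityʳ : ∀ {a b} (A : Mat a b) → (A ⊗ I) ≈ₘ A
  ⊗-identityʳ A i k = ⊗ᵥ-unit A k i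

  ⊗-intertwine : ∀ {n} {X Y P Q : Mat n n} → (Q ⊗ P) ≈ₘ I → X ≈ₘ ((P ⊗ Y) ⊗ Q) → (Q ⊗ X) ≈ₘ (Y ⊗ Q)
  ⊗-intertwine {X = X} {Y} {P} {Q} QP≈I X≈PYQ = begin
    Q ⊗ X                  ≈⟨ ⊗-congˡ Q X≈PYQ ⟩
    Q ⊗ ((P ⊗ Y) ⊗ Q)      ≈⟨ ⊗-assoc Q (P ⊗ Y) Q ⟨
    (Q ⊗ (P ⊗ Y)) ⊗ Q      ≈⟨ ⊗-congʳ Q (⊗-assoc Q P Y) ⟨
    ((Q ⊗ P) ⊗ Y) ⊗ Q      ≈⟨ ⊗-congʳ Q (⊗-congʳ Y QP≈I) ⟩
    (I ⊗ Y) ⊗ Q            ≈⟨ ⊗-congʳ Q (⊗-identityˡ Y) ⟩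
    Y ⊗ Q                  ∎
    where open SetoidReasoning (≈ₘ-setoid _ _)

  ⊗ᵥ-cancel : ∀ {a b} (A : Mat a b) (B : Mat b a) → (A ⊗ B) ≈ₘ I → ∀ v → A ⊗ᵥ (B ⊗ᵥ v) ≋ v
  ⊗ᵥ-cancel A B AB≈I v i =
    trans (sym (⊗ᵥ-assoc A B v i)) (trans (⊗ᵥ-cong AB≈I ≋-refl i) (⊗ᵥ-identityˡ v i))

  ⊗ᵥ≋0⇒≋0 : ∀ {a b} (A : Mat a b) (B : Mat b a) → (A ⊗ B) ≈ₘ I → ∀ {v} → B ⊗ᵥ v ≋ 0ᶜ → v ≋ 0ᶜ
  ⊗ᵥ≋0⇒≋0 A B AB≈I {v} Bv≋0 i =
    trans (sym (⊗ᵥ-cancel A B AB≈I v i)) (trans (⊗ᵥ-congʳ A Bv≋0 i) (⊗ᵥ-zeroʳ A i))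

  UpperTriangular-⊗ : ∀ {n} {A B : Mat n n} → UpperTriangular A → UpperTriangular B → UpperTriangular (A ⊗ B)
  UpperTriangular-⊗ {A = A} {B} uA uB i j j<i = sumF-zero entry
    where
    entry : ∀ l → A i l * B l j ≈ 0#
    entry l with toℕ l <? toℕ i
    ... | yes l<i = trans (*-congʳ (uA i l l<i)) (zeroˡ _)
    ... | no l≮i  = trans (*-congˡ (uB l j (ℕₚ.<-≤-trans j<i (ℕₚ.≮⇒≥ l≮i)))) (zeroʳ _)

  *-cancel-unit : ∀ {a b x} → b * a ≈ 1# → a * x ≈ 0# → x ≈ 0#
  *-cancel-unit {a} {b} {x} ba≈1 ax≈0 = begin
    x             ≈⟨ *-identityˡ x ⟨
    1# * x        ≈⟨ *-congʳ ba≈1 ⟨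
    (b * a) * x   ≈⟨ *-assoc b a x ⟩
    b * (a * x)   ≈⟨ *-congˡ ax≈0 ⟩
    b * 0#        ≈⟨ zeroʳ b ⟩
    0#            ∎
    where open SetoidReasoning setoid

  UpperTriangular-inverse : ∀ {p} {A B : Mat p p} → UpperTriangular A → (A ⊗ B) ≈ₘ I → UpperTriangular B
  UpperTriangular-inverse {p} {A} {B} uA AB≈I r = rowsFrom (p ∸ toℕ r) r ℕₚ.≤-refl
    where
    RowVanishes : Fin p → Set
    RowVanishes r = ∀ j → toℕ j < toℕ r → B r j ≈ 0#

    -- once all rows below r vanish left of the diagonal, row r of A ⊗ B is A r r times row r of B
    row : ∀ r → (∀ l → toℕ r < toℕ l → RowVanishes l) → RowVanishes r
    row r below j j<r = *-cancel-unit (trans (*-comm _ _) diag) off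
      where
      reduce : ∀ c → toℕ c ≤ toℕ r → (A ⊗ B) r c ≈ A r r * B r c
      reduce c c≤r = sumF-δ (λ l → A r l * B l c) r entry
        where
        entry : ∀ l → l ≢ r → A r l * B l c ≈ 0#
        entry l l≢r with toℕ l <? toℕ r
        ... | yes l<r = trans (*-congʳ (uA r l l<r)) (zeroˡ _)
        ... | no l≮r  = trans (*-congˡ (below l r<l c (ℕₚ.≤-<-trans c≤r r<l))) (zeroʳ _)
          where
          r<l : toℕ r < toℕ l
          r<l = ℕₚ.≤∧≢⇒< (ℕₚ.≮⇒≥ l≮r) (λ r≡l → l≢r (Finₚ.toℕ-injective (≡.sym r≡l)))
      diag : A r r * B r r ≈ 1#
      diag = trans (sym (reduce r ℕₚ.≤-refl)) (trans (AB≈I r r) (I-diag r))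
      off : A r r * B r j ≈ 0#
      off = trans (sym (reduce j (ℕₚ.<⇒≤ j<r)))
                  (trans (AB≈I r j) (I-off (λ r≡j → ℕₚ.<⇒≢ j<r (≡.cong toℕ (≡.sym r≡j)))))

    rowsFrom : ∀ t r → p ∸ toℕ r ≤ t → RowVanishes r
    rowsFrom t r r≥p-t =
      row r λ l r<l → smaller t l (ℕₚ.<-≤-trans (ℕₚ.∸-monoʳ-< r<l (ℕₚ.<⇒≤ (Finₚ.toℕ<n l))) r≥p-t)
      where
      smaller : ∀ t l → p ∸ toℕ l < t → RowVanishes l
      smaller zero    l ()
      smaller (suc t) l lt = rowsFrom t l (ℕₚ.≤-pred lt)

  data InitLast {n} : Fin (suc n) → Set where
    init : (i : Fin n) → InitLast (inject₁ i)
    last : InitLast (fromℕ n)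

  initLast : ∀ {n} (i : Fin (suc n)) → InitLast i
  initLast {zero}  zero    = last
  initLast {suc n} zero    = init zero
  initLast {suc n} (suc i) with initLast i
  ... | init i′ = init (suc i′)
  ... | last    = last

  fsplit-inject₁ : ∀ {n} (i : Fin n) → fsplit (inject₁ i) ≡ just i
  fsplit-inject₁ {suc n} zero    = ≡.refl
  fsplit-inject₁ {suc n} (suc i) = ≡.cong (Maybe.map suc) (fsplit-inject₁ i)

  fsplit-fromℕ : ∀ n → fsplit (fromℕ n) ≡ nothing
  fsplit-fromℕ zero    = ≡.refl
  fsplit-fromℕ (suc n) = ≡.cong (Maybe.map suc) (fsplit-fromℕ n)

  module _ {n} (X : Mat n n) (b : Col n) (k : Carrier) where

    block-init-init : ∀ i j → block X b k (inject₁ i) (inject₁ j) ≈ X i j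
    block-init-init i j rewrite fsplit-inject₁ i | fsplit-inject₁ j = refl

    block-init-last : ∀ i → block X b k (inject₁ i) (fromℕ n) ≈ b i
    block-init-last i rewrite fsplit-inject₁ i | fsplit-fromℕ n = refl

    block-last-init : ∀ j → block X b k (fromℕ n) (inject₁ j) ≈ 0#
    block-last-init j rewrite fsplit-fromℕ n | fsplit-inject₁ j = refl

    block-last-last : block X b k (fromℕ n) (fromℕ n) ≈ k
    block-last-last rewrite fsplit-fromℕ n = refl

    ≈ₘ-block : ∀ {M : Mat (suc n) (suc n)} →
      (∀ i j → M (inject₁ i) (inject₁ j) ≈ X i j) → (∀ i → M (inject₁ i) (fromℕ n) ≈ b i) →
      (∀ j → M (fromℕ n) (inject₁ j) ≈ 0#) → M (fromℕ n) (fromℕ n) ≈ k →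
      M ≈ₘ block X b k
    ≈ₘ-block ii il li ll i j with initLast i | initLast j
    ... | init i′ | init j′ = trans (ii i′ j′) (sym (block-init-init i′ j′))
    ... | init i′ | last    = trans (il i′) (sym (block-init-last i′))
    ... | last    | init j′ = trans (li j′) (sym (block-last-init j′))
    ... | last    | last    = trans ll (sym block-last-last)

  block-cong : ∀ {n} {X X′ : Mat n n} {b b′ : Col n} {k k′} → X ≈ₘ X′ → b ≋ b′ → k ≈ k′ →
    block X b k ≈ₘ block X′ b′ k′
  block-cong {X = X} {b = b} {k = k} X≈X′ b≋b′ k≈k′ = ≈ₘ-block _ _ _
    (λ i j → trans (block-init-init X b k i j) (X≈X′ i j))
    (λ i → trans (block-init-last X b k i) (b≋b′ i))
    (block-last-init X b k)
    (trans (block-last-last X b k) k≈k′)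

  block-⊗ : ∀ {n} (A : Mat n n) (u : Col n) a (B : Mat n n) (v : Col n) b →
    (block A u a ⊗ block B v b) ≈ₘ block (A ⊗ B) (λ i → (A ⊗ᵥ v) i + u i * b) (a * b)
  block-⊗ {n} A u a B v b = ≈ₘ-block _ _ _
    (λ i j → trans (split (inject₁ i) (inject₁ j))
      (trans (+-cong (sumF-cong (λ l → *-cong (block-init-init A u a i l) (block-init-init B v b l j)))
                     (trans (*-congˡ (block-last-init B v b j)) (zeroʳ _)))
             (+-identityʳ _)))
    (λ i → trans (split (inject₁ i) (fromℕ n))
      (+-cong (sumF-cong (λ l → *-cong (block-init-init A u a i l) (block-init-last B v b l)))
              (*-cong (block-init-last A u a i) (block-last-last B v b))))
    (λ j → trans (split (fromℕ n) (inject₁ j))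
      (trans (+-cong (sumF-zero (λ l → trans (*-congʳ (block-last-init A u a l)) (zeroˡ _)))
                     (trans (*-congˡ (block-last-init B v b j)) (zeroʳ _)))
             (+-identityʳ 0#)))
    (trans (split (fromℕ n) (fromℕ n))
      (trans (+-cong (sumF-zero (λ l → trans (*-congʳ (block-last-init A u a l)) (zeroˡ _)))
                     (*-cong (block-last-last A u a) (block-last-last B v b)))
             (+-identityˡ _)))
    where
    L = block A u a
    R = block B v b
    split : ∀ i j →
      (L ⊗ R) i j ≈ sumF (λ l → L i (inject₁ l) * R (inject₁ l) j) + L i (fromℕ n) * R (fromℕ n) j
    split i j = sumF-init-last (λ l → L i l * R l j)

  block-identity : ∀ {n} → block (I {n}) 0ᶜ 1# ≈ₘ I
  block-identity {n} i j with initLast i | initLast j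
  ... | init i′ | init j′ = trans (block-init-init I 0ᶜ 1# i′ j′) (I-injected (i′ ≟ j′))
    where
    I-injected : Dec (i′ ≡ j′) → I i′ j′ ≈ I (inject₁ i′) (inject₁ j′)
    I-injected (yes ≡.refl) = trans (I-diag i′) (sym (I-diag (inject₁ i′)))
    I-injected (no i′≢j′)   = trans (I-off i′≢j′) (sym (I-off (i′≢j′ ∘ Finₚ.inject₁-injective)))
  ... | init i′ | last    =
    trans (block-init-last I 0ᶜ 1# i′) (sym (I-off {i = inject₁ i′} {fromℕ n} (Finₚ.fromℕ≢inject₁ ∘ ≡.sym)))
  ... | last    | init j′ =
    trans (block-last-init I 0ᶜ 1# j′) (sym (I-off {i = fromℕ n} {inject₁ j′} Finₚ.fromℕ≢inject₁))
  ... | last    | last    = trans (block-last-last (I {n}) 0ᶜ 1#) (sym (I-diag (fromℕ n)))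

  block-upperTriangular : ∀ {n} {A : Mat n n} → UpperTriangular A → UpperTriangular (block A 0ᶜ 1#)
  block-upperTriangular {n} {A} uA i j j<i with initLast i | initLast j
  ... | init i′ | init j′ = trans (block-init-init A 0ᶜ 1# i′ j′)
          (uA i′ j′ (≡.subst₂ _<_ (Finₚ.toℕ-inject₁ j′) (Finₚ.toℕ-inject₁ i′) j<i))
  ... | init i′ | last    = ⊥-elim (ℕₚ.<-asym j<i
          (≡.subst₂ _<_ (≡.sym (Finₚ.toℕ-inject₁ i′)) (≡.sym (Finₚ.toℕ-fromℕ n)) (Finₚ.toℕ<n i′)))
  ... | last    | init j′ = block-last-init A 0ᶜ 1# j′
  ... | last    | last    = ⊥-elim (ℕₚ.<-irrefl ≡.refl j<i)

  block-inverse : ∀ {n} {A A′ : Mat n n} → (A ⊗ A′) ≈ₘ I → (block A 0ᶜ 1# ⊗ block A′ 0ᶜ 1#) ≈ₘ I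
  block-inverse {A = A} {A′} AA′≈I = ≈ₘ.trans (block-⊗ A 0ᶜ 1# A′ 0ᶜ 1#)
    (≈ₘ.trans (block-cong AA′≈I (λ i → trans (+-cong (⊗ᵥ-zeroʳ A i) (zeroˡ 1#)) (+-identityʳ 0#))
                                (*-identityˡ 1#))
              block-identity)

  block-conj : ∀ {n} (A M A′ : Mat n n) (v : Col n) →
    ((block A 0ᶜ 1# ⊗ block M v 0#) ⊗ block A′ 0ᶜ 1#) ≈ₘ block ((A ⊗ M) ⊗ A′) (A ⊗ᵥ v) 0#
  block-conj A M A′ v = ≈ₘ.trans (⊗-congʳ (block A′ 0ᶜ 1#) (block-⊗ A 0ᶜ 1# M v 0#))
    (≈ₘ.trans (block-⊗ (A ⊗ M) _ (1# * 0#) A′ 0ᶜ 1#)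
      (block-cong (λ _ _ → refl)
        (λ i → trans (+-cong (⊗ᵥ-zeroʳ (A ⊗ M) i) (*-identityʳ _))
                     (trans (+-identityˡ _) (trans (+-congˡ (zeroˡ 0#)) (+-identityʳ _))))
        (trans (*-identityʳ _) (zeroʳ 1#))))

  -- Conjugacy by invertible upper triangular matrices

  -- InConjClass together with the upper triangularity of the inverse, which makes the relation symmetric
  record Conjugate {n} (X Y : Mat n n) : Set where
    field
      P Q     : Mat n n
      P-upper : UpperTriangular P
      Q-upper : UpperTriangular Q
      P⊗Q≈I   : (P ⊗ Q) ≈ₘ I
      Q⊗P≈I   : (Q ⊗ P) ≈ₘ I
      X≈PYQ   : X ≈ₘ ((P ⊗ Y) ⊗ Q)

    Q-intertwines : (Q ⊗ X) ≈ₘ (Y ⊗ Q)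
    Q-intertwines = ⊗-intertwine Q⊗P≈I X≈PYQ

  InConjClass⇒Conjugate : ∀ {n} {X Y : Mat n n} → InConjClass X Y → Conjugate X Y
  InConjClass⇒Conjugate (P , Q , P-upper , P⊗Q≈I , Q⊗P≈I , X≈PYQ) = record
    { P = P ; Q = Q ; P-upper = P-upper ; Q-upper = UpperTriangular-inverse P-upper P⊗Q≈I
    ; P⊗Q≈I = P⊗Q≈I ; Q⊗P≈I = Q⊗P≈I ; X≈PYQ = X≈PYQ }

  Conjugate⇒InConjClass : ∀ {n} {X Y : Mat n n} → Conjugate X Y → InConjClass X Y
  Conjugate⇒InConjClass c = let open Conjugate c in P , Q , P-upper , P⊗Q≈I , Q⊗P≈I , X≈PYQ

  Conjugate-sym : ∀ {n} {X Y : Mat n n} → Conjugate X Y → Conjugate Y X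
  Conjugate-sym {X = X} {Y} c = record
    { P = Q ; Q = P ; P-upper = Q-upper ; Q-upper = P-upper ; P⊗Q≈I = Q⊗P≈I ; Q⊗P≈I = P⊗Q≈I
    ; X≈PYQ = begin
        Y                  ≈⟨ ⊗-identityʳ Y ⟨
        Y ⊗ I              ≈⟨ ⊗-congˡ Y Q⊗P≈I ⟨
        Y ⊗ (Q ⊗ P)        ≈⟨ ⊗-assoc Y Q P ⟨
        (Y ⊗ Q) ⊗ P        ≈⟨ ⊗-congʳ P Q-intertwines ⟨
        (Q ⊗ X) ⊗ P        ∎ }
    where
    open Conjugate c
    open SetoidReasoning (≈ₘ-setoid _ _)

  Conjugate-trans : ∀ {n} {X Y Z : Mat n n} → Conjugate X Y → Conjugate Y Z → Conjugate X Z
  Conjugate-trans {X = X} {Y} {Z} c d = record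
    { P = P₁ ⊗ P₂ ; Q = Q₂ ⊗ Q₁
    ; P-upper = UpperTriangular-⊗ (Conjugate.P-upper c) (Conjugate.P-upper d)
    ; Q-upper = UpperTriangular-⊗ (Conjugate.Q-upper d) (Conjugate.Q-upper c)
    ; P⊗Q≈I = cancel P₁ P₂ Q₂ Q₁ (Conjugate.P⊗Q≈I d) (Conjugate.P⊗Q≈I c)
    ; Q⊗P≈I = cancel Q₂ Q₁ P₁ P₂ (Conjugate.Q⊗P≈I c) (Conjugate.Q⊗P≈I d)
    ; X≈PYQ = begin
        X                                ≈⟨ Conjugate.X≈PYQ c ⟩
        (P₁ ⊗ Y) ⊗ Q₁                    ≈⟨ ⊗-congʳ Q₁ (⊗-congˡ P₁ (Conjugate.X≈PYQ d)) ⟩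
        (P₁ ⊗ ((P₂ ⊗ Z) ⊗ Q₂)) ⊗ Q₁      ≈⟨ ⊗-congʳ Q₁ (⊗-assoc P₁ (P₂ ⊗ Z) Q₂) ⟨
        ((P₁ ⊗ (P₂ ⊗ Z)) ⊗ Q₂) ⊗ Q₁      ≈⟨ ⊗-congʳ Q₁ (⊗-congʳ Q₂ (⊗-assoc P₁ P₂ Z)) ⟨
        (((P₁ ⊗ P₂) ⊗ Z) ⊗ Q₂) ⊗ Q₁      ≈⟨ ⊗-assoc ((P₁ ⊗ P₂) ⊗ Z) Q₂ Q₁ ⟩
        ((P₁ ⊗ P₂) ⊗ Z) ⊗ (Q₂ ⊗ Q₁)      ∎ }
    where
    open Conjugate c using () renaming (P to P₁; Q to Q₁)
    open Conjugate d using () renaming (P to P₂; Q to Q₂)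
    open SetoidReasoning (≈ₘ-setoid _ _)
    cancel : ∀ A B C D → (B ⊗ C) ≈ₘ I → (A ⊗ D) ≈ₘ I → ((A ⊗ B) ⊗ (C ⊗ D)) ≈ₘ I
    cancel A B C D BC≈I AD≈I = begin
      (A ⊗ B) ⊗ (C ⊗ D)    ≈⟨ ⊗-assoc A B (C ⊗ D) ⟩
      A ⊗ (B ⊗ (C ⊗ D))    ≈⟨ ⊗-congˡ A (⊗-assoc B C D) ⟨
      A ⊗ ((B ⊗ C) ⊗ D)    ≈⟨ ⊗-congˡ A (⊗-congʳ D BC≈I) ⟩
      A ⊗ (I ⊗ D)          ≈⟨ ⊗-congˡ A (⊗-identityˡ D) ⟩
      A ⊗ D                ≈⟨ AD≈I ⟩
      I                    ∎

  Conjugate-block : ∀ {n} {X Y : Mat n n} (c : Conjugate X Y) (d : Col n) →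
    Conjugate (block X d 0#) (block Y (Conjugate.Q c ⊗ᵥ d) 0#)
  Conjugate-block {X = X} {Y} c d = record
    { P = block P 0ᶜ 1# ; Q = block Q 0ᶜ 1#
    ; P-upper = block-upperTriangular P-upper ; Q-upper = block-upperTriangular Q-upper
    ; P⊗Q≈I = block-inverse P⊗Q≈I ; Q⊗P≈I = block-inverse Q⊗P≈I
    ; X≈PYQ = ≈ₘ.sym (≈ₘ.trans (block-conj P Y Q (Q ⊗ᵥ d))
                (block-cong (≈ₘ.sym X≈PYQ) (⊗ᵥ-cancel P Q P⊗Q≈I d) refl)) }
    where
    open Conjugate c

  -- The T-module S^m

  -- _≈ₛ_ wrapped in a record, so that both sides of an equation can be inferred from a proof of it
  infix 4 _≃_
  record _≃_ {m} (x y : SElt m) : Set where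
    constructor mk≃
    field coeff≈ : x ≈ₛ y
  open _≃_ public

  ≃-refl : ∀ {m} {x : SElt m} → x ≃ x
  ≃-refl = mk≃ (λ _ _ → refl)

  ≃-sym : ∀ {m} {x y : SElt m} → x ≃ y → y ≃ x
  ≃-sym (mk≃ e) = mk≃ (λ j i → sym (e j i))

  ≃-trans : ∀ {m} {x y z : SElt m} → x ≃ y → y ≃ z → x ≃ z
  ≃-trans (mk≃ e) (mk≃ f) = mk≃ (λ j i → trans (e j i) (f j i))

  ≃-reflexive : ∀ {m} {x y : SElt m} → x ≡ y → x ≃ y
  ≃-reflexive ≡.refl = ≃-refl

  ≃-setoid : ℕ → Setoid _ _
  ≃-setoid m = record
    { Carrier = SElt m ; _≈_ = _≃_
    ; isEquivalence = record { refl = ≃-refl ; sym = ≃-sym ; trans = ≃-trans } }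

  coeff-⊕ : ∀ {m} (x y : SElt m) j i → coeff (x ⊕ y) j i ≈ coeff x j i + coeff y j i
  coeff-⊕ []       y        j       i = sym (+-identityˡ _)
  coeff-⊕ (x ∷ xs) []       j       i = sym (+-identityʳ _)
  coeff-⊕ (x ∷ xs) (y ∷ ys) zero    i = refl
  coeff-⊕ (x ∷ xs) (y ∷ ys) (suc j) i = coeff-⊕ xs ys j i

  coeff-·ₛ : ∀ {m} k (x : SElt m) j i → coeff (k ·ₛ x) j i ≈ k * coeff x j i
  coeff-·ₛ k []       j       i = sym (zeroʳ k)
  coeff-·ₛ k (x ∷ xs) zero    i = refl
  coeff-·ₛ k (x ∷ xs) (suc j) i = coeff-·ₛ k xs j i

  coeff-Tₛ : ∀ {m} (x : SElt m) j i → coeff (Tₛ x) j i ≈ coeff x (suc j) i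
  coeff-Tₛ []      j i = refl
  coeff-Tₛ (_ ∷ _) j i = refl

  coeff-lin : ∀ {m n} (c : Col n) (ν : Fin n → SElt m) j i →
    coeff (lin c ν) j i ≈ sumF (λ l → c l * coeff (ν l) j i)
  coeff-lin {n = zero}  c ν j i = refl
  coeff-lin {n = suc n} c ν j i = trans (coeff-⊕ (c zero ·ₛ ν zero) _ j i)
    (+-cong (coeff-·ₛ (c zero) (ν zero) j i) (coeff-lin (c ∘ suc) (ν ∘ suc) j i))

  ⊕-cong : ∀ {m} {x x′ y y′ : SElt m} → x ≃ x′ → y ≃ y′ → x ⊕ y ≃ x′ ⊕ y′
  ⊕-cong {x = x} {x′} {y} {y′} (mk≃ e) (mk≃ f) = mk≃ λ j i →
    trans (coeff-⊕ x y j i) (trans (+-cong (e j i) (f j i)) (sym (coeff-⊕ x′ y′ j i)))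

  ·ₛ-cong : ∀ {m} {k k′} {x x′ : SElt m} → k ≈ k′ → x ≃ x′ → k ·ₛ x ≃ k′ ·ₛ x′
  ·ₛ-cong {k = k} {k′} {x} {x′} k≈k′ (mk≃ e) = mk≃ λ j i →
    trans (coeff-·ₛ k x j i) (trans (*-cong k≈k′ (e j i)) (sym (coeff-·ₛ k′ x′ j i)))

  Tₛ-cong : ∀ {m} {x y : SElt m} → x ≃ y → Tₛ x ≃ Tₛ y
  Tₛ-cong {x = x} {y} (mk≃ e) = mk≃ λ j i →
    trans (coeff-Tₛ x j i) (trans (e (suc j) i) (sym (coeff-Tₛ y j i)))

  Tₛ-⊕ : ∀ {m} (x y : SElt m) → Tₛ (x ⊕ y) ≃ Tₛ x ⊕ Tₛ y
  Tₛ-⊕ x y = mk≃ λ j i → begin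
    coeff (Tₛ (x ⊕ y)) j i                 ≈⟨ coeff-Tₛ (x ⊕ y) j i ⟩
    coeff (x ⊕ y) (suc j) i                ≈⟨ coeff-⊕ x y (suc j) i ⟩
    coeff x (suc j) i + coeff y (suc j) i  ≈⟨ +-cong (coeff-Tₛ x j i) (coeff-Tₛ y j i) ⟨
    coeff (Tₛ x) j i + coeff (Tₛ y) j i    ≈⟨ coeff-⊕ (Tₛ x) (Tₛ y) j i ⟨
    coeff (Tₛ x ⊕ Tₛ y) j i                ∎
    where open SetoidReasoning setoid

  Tₛ-·ₛ : ∀ {m} k (x : SElt m) → Tₛ (k ·ₛ x) ≃ k ·ₛ Tₛ x
  Tₛ-·ₛ k x = mk≃ λ j i → begin
    coeff (Tₛ (k ·ₛ x)) j i    ≈⟨ coeff-Tₛ (k ·ₛ x) j i ⟩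
    coeff (k ·ₛ x) (suc j) i   ≈⟨ coeff-·ₛ k x (suc j) i ⟩
    k * coeff x (suc j) i      ≈⟨ *-congˡ (coeff-Tₛ x j i) ⟨
    k * coeff (Tₛ x) j i       ≈⟨ coeff-·ₛ k (Tₛ x) j i ⟨
    coeff (k ·ₛ Tₛ x) j i      ∎
    where open SetoidReasoning setoid

  ⊕-identityʳ : ∀ {m} (x : SElt m) → x ⊕ 0ₛ ≡ x
  ⊕-identityʳ []      = ≡.refl
  ⊕-identityʳ (_ ∷ _) = ≡.refl

  ⊕-vanishingʳ : ∀ {m} (x y : SElt m) {a} → a ≈ 0# → x ⊕ (a ·ₛ y) ≃ x
  ⊕-vanishingʳ x y {a} a≈0 = ≃-trans (⊕-cong {x = x} ≃-refl a·y≃0) (≃-reflexive (⊕-identityʳ x))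
    where
    a·y≃0 : a ·ₛ y ≃ 0ₛ
    a·y≃0 = mk≃ λ j i → trans (coeff-·ₛ a y j i) (trans (*-congʳ a≈0) (zeroˡ _))

  lin-ext : ∀ {m n} {c d : Col n} {ν μ : Fin n → SElt m} →
    (∀ j i → sumF (λ l → c l * coeff (ν l) j i) ≈ sumF (λ l → d l * coeff (μ l) j i)) → lin c ν ≃ lin d μ
  lin-ext {c = c} {d} {ν} {μ} e =
    mk≃ λ j i → trans (coeff-lin c ν j i) (trans (e j i) (sym (coeff-lin d μ j i)))

  lin-congˡ : ∀ {m n} {c d : Col n} (ν : Fin n → SElt m) → c ≋ d → lin c ν ≃ lin d ν
  lin-congˡ {c = c} {d} ν c≋d = lin-ext {c = c} {d} {ν} {ν} (λ j i → sumF-cong (λ l → *-congʳ (c≋d l)))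

  lin-congʳ : ∀ {m n} (c : Col n) {ν μ : Fin n → SElt m} → (∀ l → ν l ≃ μ l) → lin c ν ≃ lin c μ
  lin-congʳ c {ν} {μ} ν≃μ =
    lin-ext {c = c} {c} {ν} {μ} (λ j i → sumF-cong (λ l → *-congˡ (coeff≈ (ν≃μ l) j i)))

  lin-+ : ∀ {m n} (c d : Col n) (ν : Fin n → SElt m) → lin (λ l → c l + d l) ν ≃ lin c ν ⊕ lin d ν
  lin-+ c d ν = mk≃ λ j i → begin
    coeff (lin (λ l → c l + d l) ν) j i                                 ≈⟨ coeff-lin _ ν j i ⟩
    sumF (λ l → (c l + d l) * coeff (ν l) j i)
      ≈⟨ sumF-cong (λ l → distribʳ _ (c l) (d l)) ⟩
    sumF (λ l → c l * coeff (ν l) j i + d l * coeff (ν l) j i)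
      ≈⟨ sumF-distrib-+ (λ l → c l * coeff (ν l) j i) (λ l → d l * coeff (ν l) j i) ⟩
    sumF (λ l → c l * coeff (ν l) j i) + sumF (λ l → d l * coeff (ν l) j i)
      ≈⟨ +-cong (coeff-lin c ν j i) (coeff-lin d ν j i) ⟨
    coeff (lin c ν) j i + coeff (lin d ν) j i                           ≈⟨ coeff-⊕ (lin c ν) (lin d ν) j i ⟨
    coeff (lin c ν ⊕ lin d ν) j i                                       ∎
    where open SetoidReasoning setoid

  lin-* : ∀ {m n} k (c : Col n) (ν : Fin n → SElt m) → lin (λ l → k * c l) ν ≃ k ·ₛ lin c ν
  lin-* k c ν = mk≃ λ j i → begin
    coeff (lin (λ l → k * c l) ν) j i              ≈⟨ coeff-lin _ ν j i ⟩
    sumF (λ l → (k * c l) * coeff (ν l) j i)       ≈⟨ sumF-cong (λ l → *-assoc k (c l) _) ⟩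
    sumF (λ l → k * (c l * coeff (ν l) j i))       ≈⟨ *-distribˡ-sumF k (λ l → c l * coeff (ν l) j i) ⟨
    k * sumF (λ l → c l * coeff (ν l) j i)         ≈⟨ *-congˡ (coeff-lin c ν j i) ⟨
    k * coeff (lin c ν) j i                        ≈⟨ coeff-·ₛ k (lin c ν) j i ⟨
    coeff (k ·ₛ lin c ν) j i                       ∎
    where open SetoidReasoning setoid

  lin-sub : ∀ {m n} (c d : Col n) (ν : Fin n → SElt m) j i →
    coeff (lin (λ l → c l - d l) ν) j i ≈ coeff (lin c ν) j i - coeff (lin d ν) j i
  lin-sub c d ν j i = begin
    coeff (lin (λ l → c l - d l) ν) j i                          ≈⟨ coeff-lin _ ν j i ⟩
    sumF (λ l → (c l - d l) * coeff (ν l) j i)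
      ≈⟨ sumF-cong (λ l → [y-z]x≈yx-zx _ (c l) (d l)) ⟩
    sumF (λ l → c l * coeff (ν l) j i - d l * coeff (ν l) j i)
      ≈⟨ sumF-distrib-+ (λ l → c l * coeff (ν l) j i) (λ l → - (d l * coeff (ν l) j i)) ⟩
    sumF (λ l → c l * coeff (ν l) j i) + sumF (λ l → - (d l * coeff (ν l) j i))
      ≈⟨ +-congˡ (sumF-neg (λ l → d l * coeff (ν l) j i)) ⟩
    sumF (λ l → c l * coeff (ν l) j i) - sumF (λ l → d l * coeff (ν l) j i)
      ≈⟨ +-cong (coeff-lin c ν j i) (-‿cong (coeff-lin d ν j i)) ⟨
    coeff (lin c ν) j i - coeff (lin d ν) j i                    ∎
    where open SetoidReasoning setoid

  lin-zero : ∀ {m n} (ν : Fin n → SElt m) → lin 0ᶜ ν ≃ 0ₛ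
  lin-zero ν =
    mk≃ λ j i → trans (coeff-lin 0ᶜ ν j i) (sumF-zero {f = λ l → 0# * coeff (ν l) j i} (λ l → zeroˡ _))

  Tₛ-lin : ∀ {m n} (c : Col n) (ν : Fin n → SElt m) → Tₛ (lin c ν) ≃ lin c (Tₛ ∘ ν)
  Tₛ-lin c ν = mk≃ λ j i → trans (coeff-Tₛ (lin c ν) j i) (trans (coeff-lin c ν (suc j) i)
    (trans (sumF-cong (λ l → *-congˡ (sym (coeff-Tₛ (ν l) j i)))) (sym (coeff-lin c (Tₛ ∘ ν) j i))))

  lin-⊗ᵥ : ∀ {m a b} (A : Mat a b) (c : Col b) (w : Fin a → SElt m) →
    lin c (λ l → lin (col A l) w) ≃ lin (A ⊗ᵥ c) w
  lin-⊗ᵥ A c w = mk≃ λ j i → begin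
    coeff (lin c (λ l → lin (col A l) w)) j i             ≈⟨ coeff-lin c _ j i ⟩
    sumF (λ l → c l * coeff (lin (col A l) w) j i)
      ≈⟨ sumF-cong (λ l → *-congˡ (coeff-lin (col A l) w j i)) ⟩
    sumF (λ l → c l * sumF (λ r → A r l * coeff (w r) j i))
      ≈⟨ sumF-cong (λ l → *-distribˡ-sumF (c l) (λ r → A r l * coeff (w r) j i)) ⟩
    sumF (λ l → sumF (λ r → c l * (A r l * coeff (w r) j i)))
      ≈⟨ sumF-comm (λ l r → c l * (A r l * coeff (w r) j i)) ⟩
    sumF (λ r → sumF (λ l → c l * (A r l * coeff (w r) j i)))
      ≈⟨ sumF-cong (λ r → sumF-cong (λ l → reassoc (c l) (A r l) _)) ⟩
    sumF (λ r → sumF (λ l → (A r l * c l) * coeff (w r) j i))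
      ≈⟨ sumF-cong (λ r → *-distribʳ-sumF (coeff (w r) j i) (λ l → A r l * c l)) ⟨
    sumF (λ r → (A ⊗ᵥ c) r * coeff (w r) j i)             ≈⟨ coeff-lin (A ⊗ᵥ c) w j i ⟨
    coeff (lin (A ⊗ᵥ c) w) j i                            ∎
    where
    open SetoidReasoning setoid
    reassoc : ∀ x y z → x * (y * z) ≈ (y * x) * z
    reassoc x y z = trans (x*[y*z]≈y*[x*z] x y z) (sym (*-assoc y x z))

  lin-unit : ∀ {m n} (ν : Fin n → SElt m) j → lin (unit j) ν ≃ ν j
  lin-unit ν l = mk≃ λ j i → trans (coeff-lin (unit l) ν j i)
    (trans (sumF-δ (λ r → unit l r * coeff (ν r) j i) l (λ r r≢l → trans (*-congʳ (I-off r≢l)) (zeroˡ _)))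
           (trans (*-congʳ (I-diag l)) (*-identityˡ _)))

  lin-init-last : ∀ {m n} (c : Col (suc n)) (ν : Fin (suc n) → SElt m) →
    lin c ν ≃ lin (c ∘ inject₁) (ν ∘ inject₁) ⊕ (c (fromℕ n) ·ₛ ν (fromℕ n))
  lin-init-last {n = n} c ν = mk≃ λ j i → begin
    coeff (lin c ν) j i                                            ≈⟨ coeff-lin c ν j i ⟩
    sumF (λ l → c l * coeff (ν l) j i)
      ≈⟨ sumF-init-last (λ l → c l * coeff (ν l) j i) ⟩
    sumF (λ l → c (inject₁ l) * coeff (ν (inject₁ l)) j i) + c (fromℕ n) * coeff (ν (fromℕ n)) j i
        ≈⟨ +-cong (coeff-lin (c ∘ inject₁) (ν ∘ inject₁) j i) (coeff-·ₛ (c (fromℕ n)) (ν (fromℕ n)) j i) ⟨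
    coeff (lin (c ∘ inject₁) (ν ∘ inject₁)) j i + coeff (c (fromℕ n) ·ₛ ν (fromℕ n)) j i
        ≈⟨ coeff-⊕ (lin (c ∘ inject₁) (ν ∘ inject₁)) (c (fromℕ n) ·ₛ ν (fromℕ n)) j i ⟨
    coeff (lin (c ∘ inject₁) (ν ∘ inject₁) ⊕ (c (fromℕ n) ·ₛ ν (fromℕ n))) j i ∎
    where open SetoidReasoning setoid

  lin-injective : ∀ {m n} {ν : Fin n → SElt m} → IsFlag ν → ∀ {c d} → lin c ν ≃ lin d ν → c ≋ d
  lin-injective {ν = ν} ν-flag {c} {d} (mk≃ e) l = x∙y⁻¹≈ε⇒x≈y (c l) (d l) (ν-flag _ lin[c-d]≈0 l)
    where
    lin[c-d]≈0 : lin (λ l → c l - d l) ν ≈ₛ 0ₛ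
    lin[c-d]≈0 j i = trans (lin-sub c d ν j i) (trans (+-congʳ (e j i)) (-‿inverseʳ _))

  Tₛ-basis : ∀ {m n} {ν : Fin n → SElt m} {X : Mat n n} → IsMatrixOfT ν X → ∀ j → Tₛ (ν j) ≃ lin (col X j) ν
  Tₛ-basis X-mat j = mk≃ (X-mat j)

  Tₛ-lin-matrix : ∀ {m n} {ν : Fin n → SElt m} {X : Mat n n} → IsMatrixOfT ν X →
    ∀ c → Tₛ (lin c ν) ≃ lin (X ⊗ᵥ c) ν
  Tₛ-lin-matrix {ν = ν} {X} X-mat c =
    ≃-trans (Tₛ-lin c ν) (≃-trans (lin-congʳ c (Tₛ-basis X-mat)) (lin-⊗ᵥ X c ν))

  unit-suppBelow : ∀ {n} (j : Fin n) → SuppBelow (suc (toℕ j)) (unit j)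
  unit-suppBelow j l j<l = I-off (λ l≡j → ℕₚ.<-irrefl (≡.cong toℕ (≡.sym l≡j)) j<l)

  basis-inSpan : ∀ {m n} (ν : Fin n → SElt m) j → InSpan (suc (toℕ j)) ν (ν j)
  basis-inSpan ν j = unit j , unit-suppBelow j , coeff≈ (≃-sym (lin-unit ν j))

  UpperTriangular-suppBelow : ∀ {n} {M : Mat n n} → UpperTriangular M →
    ∀ i c → SuppBelow i c → SuppBelow i (M ⊗ᵥ c)
  UpperTriangular-suppBelow {M = M} M-upper i c c-supp r i≤r = sumF-zero entry
    where
    entry : ∀ l → M r l * c l ≈ 0#
    entry l with i ≤? toℕ l
    ... | yes i≤l = trans (*-congˡ (c-supp l i≤l)) (zeroʳ _)
    ... | no i≰l  = trans (*-congʳ (M-upper r l (ℕₚ.<-≤-trans (ℕₚ.≰⇒> i≰l) i≤r))) (zeroˡ _)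

  module _ {m p} {ν w : Fin p → SElt m} {f : Fin p → SElt m} (iso : IsoVia ν w f) where

    private
      images-inSpan = proj₁ iso
      preimages     = proj₁ (proj₂ iso)
      injective     = proj₁ (proj₂ (proj₂ iso))
      commutesWithT = proj₂ (proj₂ (proj₂ iso))

    IsoVia-isFlag : IsFlag ν → IsFlag f
    IsoVia-isFlag ν-flag c lin≈0 = ν-flag c (injective c lin≈0)

    IsoVia-matrix : ∀ {X} → IsMatrixOfT ν X → IsMatrixOfT f X
    IsoVia-matrix {X} X-mat j =
      coeff≈ (≃-trans (Tₛ-cong (≃-sym (lin-unit f j))) (mk≃ {x = Tₛ (lin (unit j) f)} {lin (col X j) f} Tf≈Xf))
      where
      Tf≈Xf : Tₛ (lin (unit j) f) ≈ₛ lin (col X j) f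
      Tf≈Xf = commutesWithT (unit j) (col X j) (coeff≈ (≃-trans (Tₛ-cong (lin-unit ν j)) (Tₛ-basis X-mat j)))

    imageCoordinates : Σ (Mat p p) λ A → UpperTriangular A × (∀ j → f j ≃ lin (col A j) w)
    imageCoordinates = (λ l j → proj₁ (spanned j) l) , (λ l j → proj₁ (proj₂ (spanned j)) l) ,
      λ j → ≃-trans (≃-sym (lin-unit f j)) (mk≃ {y = lin (proj₁ (spanned j)) w} (proj₂ (proj₂ (spanned j))))
      where
      spanned : ∀ j → InSpan (suc (toℕ j)) w (lin (unit j) f)
      spanned j = images-inSpan (suc (toℕ j)) (unit j) (unit-suppBelow j)

    preimageCoordinates : Σ (Mat p p) λ B → UpperTriangular B × (∀ j → w j ≃ lin (col B j) f)
    preimageCoordinates = (λ l j → proj₁ (spanned j) l) , (λ l j → proj₁ (proj₂ (spanned j)) l) ,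
      λ j → ≃-sym (mk≃ {x = lin (proj₁ (spanned j)) f} (proj₂ (proj₂ (spanned j))))
      where
      spanned : ∀ j → ∃ λ c → SuppBelow (suc (toℕ j)) c × (lin c f ≈ₛ w j)
      spanned j = preimages (suc (toℕ j)) (w j) (basis-inSpan w j)

  coordinates-inverse : ∀ {m p} {f w : Fin p → SElt m} {A B : Mat p p} → IsFlag w →
    (∀ j → f j ≃ lin (col A j) w) → (∀ j → w j ≃ lin (col B j) f) → (A ⊗ B) ≈ₘ I
  coordinates-inverse {f = f} {w} {A} {B} w-flag f≃Aw w≃Bf i j = sym (lin-injective w-flag lin-eq i)
    where
    open SetoidReasoning (≃-setoid _)
    lin-eq : lin (unit j) w ≃ lin (A ⊗ᵥ col B j) w
    lin-eq = begin
      lin (unit j) w                          ≈⟨ lin-unit w j ⟩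
      w j                                     ≈⟨ w≃Bf j ⟩
      lin (col B j) f                         ≈⟨ lin-congʳ (col B j) f≃Aw ⟩
      lin (col B j) (λ l → lin (col A l) w)   ≈⟨ lin-⊗ᵥ A (col B j) w ⟩
      lin (A ⊗ᵥ col B j) w                    ∎

  coordinates-intertwine : ∀ {m p} {f w : Fin p → SElt m} {A X Y : Mat p p} → IsFlag w →
    IsMatrixOfT f X → IsMatrixOfT w Y → (∀ j → f j ≃ lin (col A j) w) → (Y ⊗ A) ≈ₘ (A ⊗ X)
  coordinates-intertwine {f = f} {w} {A} {X} {Y} w-flag X-mat Y-mat f≃Aw i j = lin-injective w-flag lin-eq i
    where
    open SetoidReasoning (≃-setoid _)
    lin-eq : lin (Y ⊗ᵥ col A j) w ≃ lin (A ⊗ᵥ col X j) w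
    lin-eq = begin
      lin (Y ⊗ᵥ col A j) w                    ≈⟨ Tₛ-lin-matrix Y-mat (col A j) ⟨
      Tₛ (lin (col A j) w)                    ≈⟨ Tₛ-cong (f≃Aw j) ⟨
      Tₛ (f j)                                ≈⟨ Tₛ-basis X-mat j ⟩
      lin (col X j) f                         ≈⟨ lin-congʳ (col X j) f≃Aw ⟩
      lin (col X j) (λ l → lin (col A l) w)   ≈⟨ lin-⊗ᵥ A (col X j) w ⟩
      lin (A ⊗ᵥ col X j) w                    ∎

  Iso⇒Conjugate : ∀ {m p} {ν w : Fin p → SElt m} {X Y : Mat p p} → IsFlag ν → IsFlag w →
    IsMatrixOfT ν X → IsMatrixOfT w Y → Iso ν w → Conjugate X Y
  Iso⇒Conjugate {X = X} {Y} ν-flag w-flag X-mat Y-mat (f , iso) = record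
    { P = B ; Q = A ; P-upper = B-upper ; Q-upper = A-upper ; P⊗Q≈I = B⊗A≈I ; Q⊗P≈I = A⊗B≈I
    ; X≈PYQ = begin
        X                 ≈⟨ ⊗-identityˡ X ⟨
        I ⊗ X             ≈⟨ ⊗-congʳ X B⊗A≈I ⟨
        (B ⊗ A) ⊗ X       ≈⟨ ⊗-assoc B A X ⟩
        B ⊗ (A ⊗ X)
          ≈⟨ ⊗-congˡ B (coordinates-intertwine w-flag (IsoVia-matrix iso X-mat) Y-mat f≃Aw) ⟨
        B ⊗ (Y ⊗ A)       ≈⟨ ⊗-assoc B Y A ⟨
        (B ⊗ Y) ⊗ A       ∎ }
    where
    open SetoidReasoning (≈ₘ-setoid _ _)
    A = proj₁ (imageCoordinates iso)
    A-upper = proj₁ (proj₂ (imageCoordinates iso))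
    f≃Aw = proj₂ (proj₂ (imageCoordinates iso))
    B = proj₁ (preimageCoordinates iso)
    B-upper = proj₁ (proj₂ (preimageCoordinates iso))
    w≃Bf = proj₂ (proj₂ (preimageCoordinates iso))
    A⊗B≈I = coordinates-inverse w-flag f≃Aw w≃Bf
    B⊗A≈I = coordinates-inverse (IsoVia-isFlag iso ν-flag) w≃Bf f≃Aw

  Conjugate⇒Iso : ∀ {m p} {ν w : Fin p → SElt m} {X Y : Mat p p} → IsFlag ν → IsFlag w →
    IsMatrixOfT ν X → IsMatrixOfT w Y → Conjugate X Y → Iso ν w
  Conjugate⇒Iso {ν = ν} {w} {X} {Y} ν-flag w-flag X-mat Y-mat c =
    f , images-inSpan , preimages , injective , commutesWithT
    where
    open Conjugate c
    f = λ l → lin (col Q l) w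

    lin-f : ∀ c → lin c f ≃ lin (Q ⊗ᵥ c) w
    lin-f c = lin-⊗ᵥ Q c w

    images-inSpan : ∀ i c → SuppBelow i c → InSpan i w (lin c f)
    images-inSpan i c c-supp = Q ⊗ᵥ c , UpperTriangular-suppBelow Q-upper i c c-supp , coeff≈ (lin-f c)

    preimages : ∀ i x → InSpan i w x → ∃ λ c → SuppBelow i c × (lin c f ≈ₛ x)
    preimages i x (e , e-supp , x≈) = P ⊗ᵥ e , UpperTriangular-suppBelow P-upper i e e-supp ,
      coeff≈ (≃-trans (lin-f (P ⊗ᵥ e))
               (≃-trans (lin-congˡ w (⊗ᵥ-cancel Q P Q⊗P≈I e)) (≃-sym (mk≃ {x = x} x≈))))

    injective : ∀ c → lin c f ≈ₛ 0ₛ → lin c ν ≈ₛ 0ₛ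
    injective c lin≈0 = coeff≈ (≃-trans (lin-congˡ ν (⊗ᵥ≋0⇒≋0 P Q P⊗Q≈I Qc≋0)) (lin-zero ν))
      where
      Qc≋0 : Q ⊗ᵥ c ≋ 0ᶜ
      Qc≋0 = w-flag _ (coeff≈ (≃-trans (≃-sym (lin-f c)) (mk≃ {y = 0ₛ} lin≈0)))

    commutesWithT : ∀ c d → Tₛ (lin c ν) ≈ₛ lin d ν → Tₛ (lin c f) ≈ₛ lin d f
    commutesWithT c d Tc≈d = coeff≈ (begin
      Tₛ (lin c f)                ≈⟨ Tₛ-cong (lin-f c) ⟩
      Tₛ (lin (Q ⊗ᵥ c) w)         ≈⟨ Tₛ-lin-matrix Y-mat (Q ⊗ᵥ c) ⟩
      lin (Y ⊗ᵥ (Q ⊗ᵥ c)) w       ≈⟨ lin-congˡ w YQc≋Qd ⟩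
      lin (Q ⊗ᵥ d) w              ≈⟨ lin-f d ⟨
      lin d f                     ∎)
      where
      open SetoidReasoning (≃-setoid _)
      Xc≋d : X ⊗ᵥ c ≋ d
      Xc≋d = lin-injective ν-flag (≃-trans (≃-sym (Tₛ-lin-matrix X-mat c)) (mk≃ Tc≈d))
      YQc≋Qd : Y ⊗ᵥ (Q ⊗ᵥ c) ≋ Q ⊗ᵥ d
      YQc≋Qd i = trans (sym (⊗ᵥ-assoc Y Q c i)) (trans (⊗ᵥ-cong (≈ₘ.sym Q-intertwines) ≋-refl i)
                   (trans (⊗ᵥ-assoc Q X c i) (⊗ᵥ-congʳ Q Xc≋d i)))

  -- Torsion flags, parents and children

  suppBelow-all : ∀ {n} (c : Col n) → SuppBelow n c
  suppBelow-all c l n≤l = ⊥-elim (ℕₚ.<⇒≱ (Finₚ.toℕ<n l) n≤l)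

  IsMatrixOfT-unique : ∀ {m n} {ν : Fin n → SElt m} {X Y : Mat n n} → IsFlag ν →
    IsMatrixOfT ν X → IsMatrixOfT ν Y → X ≈ₘ Y
  IsMatrixOfT-unique ν-flag X-mat Y-mat i j =
    lin-injective ν-flag (≃-trans (≃-sym (Tₛ-basis X-mat j)) (Tₛ-basis Y-mat j)) i

  torsion-matrix : ∀ {m n} {ν : Fin n → SElt m} → IsTorsion ν →
    Σ (Mat n n) λ N → IsMatrixOfT ν N × (∀ j → SuppBelow (toℕ j) (col N j))
  torsion-matrix {ν = ν} torsion =
    (λ i j → proj₁ (Tν j) i) , (λ j → proj₂ (proj₂ (Tν j))) , (λ j → proj₁ (proj₂ (Tν j)))
    where
    Tν : ∀ j → InSpan (toℕ j) ν (Tₛ (ν j))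
    Tν j = torsion (toℕ j) (Finₚ.toℕ<n j) (ν j) (basis-inSpan ν j)

  extend : ∀ {n} → Col n → Carrier → Col (suc n)
  extend c a i with fsplit i
  ... | just j  = c j
  ... | nothing = a

  extend-inject₁ : ∀ {n} (c : Col n) a j → extend c a (inject₁ j) ≈ c j
  extend-inject₁ c a j rewrite fsplit-inject₁ j = refl

  extend-fromℕ : ∀ {n} (c : Col n) a → extend c a (fromℕ n) ≈ a
  extend-fromℕ {n} c a rewrite fsplit-fromℕ n = refl

  parent-isFlag : ∀ {m n} {ν′ : Fin (suc n) → SElt m} → IsFlag ν′ → IsFlag (parent ν′)
  parent-isFlag {n = n} {ν′} ν′-flag c lin≈0 j =
    trans (sym (extend-inject₁ c 0# j)) (ν′-flag (extend c 0#) lin′≈0 (inject₁ j))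
    where
    lin′≈0 : lin (extend c 0#) ν′ ≈ₛ 0ₛ
    lin′≈0 = coeff≈ (≃-trans (lin-init-last (extend c 0#) ν′)
      (≃-trans (⊕-vanishingʳ _ _ (extend-fromℕ c 0#))
      (≃-trans (lin-congˡ (parent ν′) (extend-inject₁ c 0#)) (mk≃ {y = 0ₛ} lin≈0))))

  parent-matrix : ∀ {m n} {ν′ : Fin (suc n) → SElt m} {N′ : Mat (suc n) (suc n)} →
    IsTorsionFlag ν′ → IsMatrixOfT ν′ N′ → IsMatrixOfT (parent ν′) (topLeft N′)
  parent-matrix {n = n} {ν′} {N′} (ν′-flag , torsion) N′-mat j =
    coeff≈ (≃-trans (Tₛ-basis {ν = ν′} {N′} N′-mat (inject₁ j))
             (≃-trans (lin-init-last (col N′ (inject₁ j)) ν′)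
                      (⊕-vanishingʳ (lin (λ i → topLeft N′ i j) (parent ν′)) (ν′ (fromℕ n)) lastRow≈0)))
    where
    N = torsion-matrix {ν = ν′} torsion
    j<n : toℕ (inject₁ j) < toℕ (fromℕ n)
    j<n = ≡.subst₂ _<_ (≡.sym (Finₚ.toℕ-inject₁ j)) (≡.sym (Finₚ.toℕ-fromℕ n)) (Finₚ.toℕ<n j)
    lastRow≈0 : N′ (fromℕ n) (inject₁ j) ≈ 0#
    lastRow≈0 = trans (IsMatrixOfT-unique {ν = ν′} {N′} {proj₁ N} ν′-flag N′-mat (proj₁ (proj₂ N))
                                          (fromℕ n) (inject₁ j))
                      (proj₂ (proj₂ N) (inject₁ j) (fromℕ n) (ℕₚ.<⇒≤ j<n))

  module _ {m n} (ν : Fin n → SElt m) (x : SElt m) where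

    snoc-inject₁ : ∀ j → snoc ν x (inject₁ j) ≡ ν j
    snoc-inject₁ j rewrite fsplit-inject₁ j = ≡.refl

    snoc-fromℕ : snoc ν x (fromℕ n) ≡ x
    snoc-fromℕ rewrite fsplit-fromℕ n = ≡.refl

    snoc-lin : ∀ c → lin c (snoc ν x) ≃ lin (c ∘ inject₁) ν ⊕ (c (fromℕ n) ·ₛ x)
    snoc-lin c = ≃-trans (lin-init-last c (snoc ν x))
      (⊕-cong (lin-congʳ (c ∘ inject₁) (λ l → ≃-reflexive (snoc-inject₁ l)))
              (·ₛ-cong refl (≃-reflexive snoc-fromℕ)))

  snoc-matrix : ∀ {m n} {ν : Fin n → SElt m} {x : SElt m} {N : Mat n n} {d : Col n} →
    IsMatrixOfT ν N → Tₛ x ≃ lin d ν → IsMatrixOfT (snoc ν x) (block N d 0#)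
  snoc-matrix {n = n} {ν} {x} {N} {d} N-mat Tx≃d j = coeff≈ (column j)
    where
    B = block N d 0#
    lastRow≈0 : ∀ j → B (fromℕ n) j ≈ 0#
    lastRow≈0 j with initLast j
    ... | init j′ = block-last-init N d 0# j′
    ... | last    = block-last-last N d 0#
    dropLast : ∀ j → lin (col B j) (snoc ν x) ≃ lin (λ l → B (inject₁ l) j) ν
    dropLast j =
      ≃-trans (snoc-lin ν x (col B j)) (⊕-vanishingʳ (lin (λ l → B (inject₁ l) j) ν) x (lastRow≈0 j))
    column : ∀ j → Tₛ (snoc ν x j) ≃ lin (col B j) (snoc ν x)
    column j with initLast j
    ... | init j′ = ≃-trans (Tₛ-cong (≃-reflexive (snoc-inject₁ ν x j′))) (≃-trans (Tₛ-basis {X = N} N-mat j′)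
        (≃-sym (≃-trans (dropLast (inject₁ j′)) (lin-congˡ ν (λ l → block-init-init N d 0# l j′)))))
    ... | last    = ≃-trans (Tₛ-cong (≃-reflexive (snoc-fromℕ ν x))) (≃-trans Tx≃d
        (≃-sym (≃-trans (dropLast (fromℕ n)) (lin-congˡ ν (block-init-last N d 0#)))))

  u+ay≈0⇒y≈-bu : ∀ {u a b y} → u + a * y ≈ 0# → b * a ≈ 1# → y ≈ (- b) * u
  u+ay≈0⇒y≈-bu {u} {a} {b} {y} u+ay≈0 ba≈1 = begin
    y             ≈⟨ *-identityˡ y ⟨
    1# * y        ≈⟨ *-congʳ ba≈1 ⟨
    (b * a) * y   ≈⟨ *-assoc b a y ⟩
    b * (a * y)   ≈⟨ *-congˡ (+-inverseʳ-unique u (a * y) u+ay≈0) ⟩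
    b * (- u)     ≈⟨ -‿distribʳ-* b u ⟨
    - (b * u)     ≈⟨ -‿distribˡ-* b u ⟩
    (- b) * u     ∎
    where open SetoidReasoning setoid

  snoc-isFlag : ∀ {m n} {ν : Fin n → SElt m} {x : SElt m} → IsFlag ν → ¬ InSpan n ν x → IsFlag (snoc ν x)
  snoc-isFlag {n = n} {ν} {x} ν-flag x∉V c lin≈0 = c≋0
    where
    split≃0 : lin (c ∘ inject₁) ν ⊕ (c (fromℕ n) ·ₛ x) ≃ 0ₛ
    split≃0 = ≃-trans (≃-sym (snoc-lin ν x c)) (mk≃ {y = 0ₛ} lin≈0)
    last≈0 : c (fromℕ n) ≈ 0#
    last≈0 with decEq (c (fromℕ n)) 0#
    ... | yes a≈0 = a≈0
    ... | no a≉0  = ⊥-elim (x∉V (w , suppBelow-all w , x≈w))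
      where
      b = proj₁ (inverse _ a≉0)
      ba≈1 = trans (*-comm b _) (proj₂ (inverse _ a≉0))
      w = λ l → (- b) * c (inject₁ l)
      u+ax≈0 : ∀ j i → coeff (lin (c ∘ inject₁) ν) j i + c (fromℕ n) * coeff x j i ≈ 0#
      u+ax≈0 j i = trans (+-congˡ (sym (coeff-·ₛ _ x j i)))
        (trans (sym (coeff-⊕ (lin (c ∘ inject₁) ν) (c (fromℕ n) ·ₛ x) j i)) (coeff≈ split≃0 j i))
      x≈w : x ≈ₛ lin w ν
      x≈w j i = trans (u+ay≈0⇒y≈-bu (u+ax≈0 j i) ba≈1)
        (trans (sym (coeff-·ₛ (- b) (lin (c ∘ inject₁) ν) j i))
               (coeff≈ (≃-sym (lin-* (- b) (c ∘ inject₁) ν)) j i))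
    c≋0 : c ≋ 0ᶜ
    c≋0 i with initLast i
    ... | init j = ν-flag (c ∘ inject₁) (coeff≈ (≃-trans (≃-sym (⊕-vanishingʳ _ x last≈0)) split≃0)) j
    ... | last   = last≈0

  -- Orbits of the matrices ( N b ; 0 0 )

  ProportionalModImage : ∀ {n} → Mat n n → Col n → Col n → Set
  ProportionalModImage N b b′ = ∃ λ k → ¬ (k ≈ 0#) × ∃ λ c → ∀ i → b i + (- k) * b′ i ≈ (N ⊗ᵥ c) i

  ProportionalModImage-resp : ∀ {n} (N : Mat n n) {b₁ b₂ b₁′ b₂′ : Col n} → b₁ ≋ b₂ → b₁′ ≋ b₂′ →
    ProportionalModImage N b₁ b₁′ → ProportionalModImage N b₂ b₂′
  ProportionalModImage-resp N b₁≋b₂ b₁′≋b₂′ (k , k≉0 , c , eq) =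
    k , k≉0 , c , λ i → trans (+-cong (sym (b₁≋b₂ i)) (*-congˡ (sym (b₁′≋b₂′ i)))) (eq i)

  ProportionalModImage-map : ∀ {n} {S M₁ M₂ : Mat n n} → (S ⊗ M₁) ≈ₘ (M₂ ⊗ S) → ∀ {d d′} →
    ProportionalModImage M₁ d d′ → ProportionalModImage M₂ (S ⊗ᵥ d) (S ⊗ᵥ d′)
  ProportionalModImage-map {S = S} {M₁} {M₂} SM₁≈M₂S {d} {d′} (k , k≉0 , c , eq) =
    k , k≉0 , S ⊗ᵥ c , λ i → begin
    (S ⊗ᵥ d) i + (- k) * (S ⊗ᵥ d′) i        ≈⟨ +-congˡ (⊗ᵥ-* S (- k) d′ i) ⟨
    (S ⊗ᵥ d) i + (S ⊗ᵥ (λ l → (- k) * d′ l)) i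
                                            ≈⟨ ⊗ᵥ-distrib-+ S d (λ l → (- k) * d′ l) i ⟨
    (S ⊗ᵥ (λ l → d l + (- k) * d′ l)) i     ≈⟨ ⊗ᵥ-congʳ S eq i ⟩
    (S ⊗ᵥ (M₁ ⊗ᵥ c)) i                      ≈⟨ ⊗ᵥ-assoc S M₁ c i ⟨
    ((S ⊗ M₁) ⊗ᵥ c) i                       ≈⟨ ⊗ᵥ-cong SM₁≈M₂S ≋-refl i ⟩
    ((M₂ ⊗ S) ⊗ᵥ c) i                       ≈⟨ ⊗ᵥ-assoc M₂ S c i ⟩
    (M₂ ⊗ᵥ (S ⊗ᵥ c)) i                      ∎
    where open SetoidReasoning setoid

  [u+vk]+[-k]v≈u : ∀ u v k → (u + v * k) + (- k) * v ≈ u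
  [u+vk]+[-k]v≈u u v k = begin
    (u + v * k) + (- k) * v     ≈⟨ +-congˡ (-‿distribˡ-* k v) ⟨
    (u + v * k) + - (k * v)     ≈⟨ +-congʳ (+-congˡ (*-comm v k)) ⟩
    (u + k * v) + - (k * v)     ≈⟨ +-assoc u _ _ ⟩
    u + (k * v + - (k * v))     ≈⟨ +-congˡ (-‿inverseʳ _) ⟩
    u + 0#                      ≈⟨ +-identityʳ u ⟩
    u                           ∎
    where open SetoidReasoning setoid

  [-a]x+xa≈0 : ∀ a x → (- a) * x + x * a ≈ 0#
  [-a]x+xa≈0 a x = trans (+-cong (sym (-‿distribˡ-* a x)) (*-comm x a)) (-‿inverseˡ _)

  x+[-a]xb≈0 : ∀ {a b} x → a * b ≈ 1# → x + ((- a) * x) * b ≈ 0#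
  x+[-a]xb≈0 {a} {b} x ab≈1 = trans (+-congˡ [-a]xb≈-x) (-‿inverseʳ x)
    where
    open SetoidReasoning setoid
    [-a]xb≈-x : ((- a) * x) * b ≈ - x
    [-a]xb≈-x = begin
      ((- a) * x) * b     ≈⟨ *-assoc (- a) x b ⟩
      (- a) * (x * b)     ≈⟨ *-congˡ (*-comm x b) ⟩
      (- a) * (b * x)     ≈⟨ *-assoc (- a) b x ⟨
      ((- a) * b) * x     ≈⟨ *-congʳ (-‿distribˡ-* a b) ⟨
      (- (a * b)) * x     ≈⟨ *-congʳ (-‿cong ab≈1) ⟩
      (- 1#) * x          ≈⟨ -1*x≈-x x ⟩
      - x                 ∎

  [-a][b+[-k]b′]+ba≈b′ : ∀ {a k} b b′ → a * k ≈ 1# → (- a) * (b + (- k) * b′) + b * a ≈ b′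
  [-a][b+[-k]b′]+ba≈b′ {a} {k} b b′ ak≈1 = begin
    (- a) * (b + (- k) * b′) + b * a              ≈⟨ +-congʳ (distribˡ (- a) b _) ⟩
    ((- a) * b + (- a) * ((- k) * b′)) + b * a    ≈⟨ +-congʳ (+-comm _ _) ⟩
    ((- a) * ((- k) * b′) + (- a) * b) + b * a    ≈⟨ +-assoc _ _ _ ⟩
    (- a) * ((- k) * b′) + ((- a) * b + b * a)    ≈⟨ +-congˡ ([-a]x+xa≈0 a b) ⟩
    (- a) * ((- k) * b′) + 0#                     ≈⟨ +-identityʳ _ ⟩
    (- a) * ((- k) * b′)                          ≈⟨ *-assoc (- a) (- k) b′ ⟨
    ((- a) * (- k)) * b′                          ≈⟨ *-congʳ [-a][-k]≈ak ⟩
    (a * k) * b′                                  ≈⟨ *-congʳ ak≈1 ⟩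
    1# * b′                                       ≈⟨ *-identityˡ b′ ⟩
    b′                                            ∎
    where
    open SetoidReasoning setoid
    [-a][-k]≈ak : (- a) * (- k) ≈ a * k
    [-a][-k]≈ak =
      trans (sym (-‿distribˡ-* a (- k))) (trans (-‿cong (sym (-‿distribʳ-* a k))) (-‿involutive _))

  block-row-fixes : ∀ {n} (N : Mat n n) b c k → (block I c k ⊗ block N b 0#) ≈ₘ block N b 0#
  block-row-fixes N b c k = ≈ₘ.trans (block-⊗ I c k N b 0#)
    (block-cong (⊗-identityˡ N) (λ i → trans (+-cong (⊗ᵥ-identityˡ b i) (zeroʳ _)) (+-identityʳ _)) (zeroʳ k))

  BOrbit⇒ProportionalModImage : ∀ {n} (N : Mat n n) {b b′} → BOrbit N b b′ → ProportionalModImage N b b′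
  BOrbit⇒ProportionalModImage {n} N {b} {b′} (c , k , k≉0 , H , _ , HG≈I , GBH≈B′) =
    k , k≉0 , c , λ i → trans (+-congʳ (b≈Nc+b′k i)) ([u+vk]+[-k]v≈u ((N ⊗ᵥ c) i) (b′ i) k)
    where
    G = block I c k
    B = block N b 0#
    B′ = block N b′ 0#
    open SetoidReasoning (≈ₘ-setoid _ _)
    B≈B′G : B ≈ₘ block (N ⊗ I) (λ i → (N ⊗ᵥ c) i + b′ i * k) (0# * k)
    B≈B′G = begin
      B                   ≈⟨ ⊗-identityʳ B ⟨
      B ⊗ I               ≈⟨ ⊗-congˡ B HG≈I ⟨
      B ⊗ (H ⊗ G)         ≈⟨ ⊗-assoc B H G ⟨
      (B ⊗ H) ⊗ G         ≈⟨ ⊗-congʳ G (⊗-congʳ H (block-row-fixes N b c k)) ⟨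
      ((G ⊗ B) ⊗ H) ⊗ G   ≈⟨ ⊗-congʳ G GBH≈B′ ⟩
      B′ ⊗ G              ≈⟨ block-⊗ N b′ 0# I c k ⟩
      block (N ⊗ I) (λ i → (N ⊗ᵥ c) i + b′ i * k) (0# * k) ∎
    b≈Nc+b′k : ∀ i → b i ≈ (N ⊗ᵥ c) i + b′ i * k
    b≈Nc+b′k i = trans (sym (block-init-last N b 0# i))
      (trans (B≈B′G (inject₁ i) (fromℕ n)) (block-init-last (N ⊗ I) _ (0# * k) i))

  ProportionalModImage⇒BOrbit : ∀ {n} (N : Mat n n) {b b′} → ProportionalModImage N b b′ → BOrbit N b b′
  ProportionalModImage⇒BOrbit {n} N {b} {b′} (k , k≉0 , c , eq) = c , k , k≉0 , H , G⊗H≈I , H⊗G≈I , GBH≈B′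
    where
    k⁻¹ = proj₁ (inverse k k≉0)
    kk⁻¹≈1 = proj₂ (inverse k k≉0)
    k⁻¹k≈1 = trans (*-comm k⁻¹ k) kk⁻¹≈1
    G = block I c k
    H = block I (λ i → (- k⁻¹) * c i) k⁻¹
    G⊗H≈I : (G ⊗ H) ≈ₘ I
    G⊗H≈I = ≈ₘ.trans (block-⊗ I c k I _ k⁻¹)
      (≈ₘ.trans (block-cong (⊗-identityˡ I) (λ i → trans (+-congʳ (⊗ᵥ-identityˡ _ i)) ([-a]x+xa≈0 k⁻¹ (c i)))
                            kk⁻¹≈1)
                block-identity)
    H⊗G≈I : (H ⊗ G) ≈ₘ I
    H⊗G≈I = ≈ₘ.trans (block-⊗ I _ k⁻¹ I c k)
      (≈ₘ.trans (block-cong (⊗-identityˡ I) (λ i → trans (+-congʳ (⊗ᵥ-identityˡ c i)) (x+[-a]xb≈0 (c i) k⁻¹k≈1))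
                            k⁻¹k≈1)
                block-identity)
    GBH≈B′ : ((G ⊗ block N b 0#) ⊗ H) ≈ₘ block N b′ 0#
    GBH≈B′ = ≈ₘ.trans (⊗-congʳ H (block-row-fixes N b c k)) (≈ₘ.trans (block-⊗ N b 0# I _ k⁻¹)
      (block-cong (⊗-identityʳ N)
        (λ i → trans (+-congʳ (trans (⊗ᵥ-* N (- k⁻¹) c i) (*-congˡ (sym (eq i)))))
                     ([-a][b+[-k]b′]+ba≈b′ (b i) (b′ i) k⁻¹k≈1))
        (zeroˡ k⁻¹)))

  LinearlyDependent : ∀ {p m} → (Fin p → Col m) → Set
  LinearlyDependent {p} h = Σ (Col p) λ μ → (∃ λ j → ¬ (μ j ≈ 0#)) × (∀ i → sumF (λ j → μ j * h j i) ≈ 0#)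

  -- one step of Gaussian elimination with pivot vector h p
  module Elimination {m} (h : Fin (suc (suc m)) → Col (suc m)) (p : Fin (suc (suc m))) (g : Col (suc m)) where

    reduced : Fin (suc m) → Col m
    reduced j i = h (punchIn p j) (suc i) + (- g j) * h p (suc i)

    FirstCoordinateCancels : Set
    FirstCoordinateCancels = ∀ (μ : Col (suc m)) →
      (- sumF (λ j → μ j * g j)) * h p zero + sumF (λ j → μ j * h (punchIn p j) zero) ≈ 0#

    dependent-lift : FirstCoordinateCancels → LinearlyDependent reduced → LinearlyDependent h
    dependent-lift firstCancels (μ , (j₀ , μj₀≉0) , μ-rel) =
      μ′ , (punchIn p j₀ , λ e → μj₀≉0 (trans (sym (reflexive (insertAt-punchIn μ p t j₀))) e)) , rel
      where
      open SetoidReasoning setoid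
      t = - sumF (λ j → μ j * g j)
      μ′ = insertAt μ p t
      expand : ∀ i → sumF (λ j → μ′ j * h j i) ≈ t * h p i + sumF (λ j → μ j * h (punchIn p j) i)
      expand i = trans (sumF-remove (λ j → μ′ j * h j i) p)
        (+-cong (*-congʳ (reflexive (insertAt-lookup μ p t)))
                (sumF-cong {f = λ j → μ′ (punchIn p j) * h (punchIn p j) i}
                           (λ j → *-congʳ (reflexive (insertAt-punchIn μ p t j)))))
      pivotTerm : ∀ x → sumF (λ j → μ j * ((- g j) * x)) ≈ t * x
      pivotTerm x = begin
        sumF (λ j → μ j * ((- g j) * x))   ≈⟨ sumF-cong (λ j → trans (sym (*-assoc (μ j) (- g j) x))
                                                          (*-congʳ (sym (-‿distribʳ-* (μ j) (g j))))) ⟩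
        sumF (λ j → (- (μ j * g j)) * x)   ≈⟨ *-distribʳ-sumF x (λ j → - (μ j * g j)) ⟨
        sumF (λ j → - (μ j * g j)) * x     ≈⟨ *-congʳ (sumF-neg (λ j → μ j * g j)) ⟩
        t * x                              ∎
      rel : ∀ i → sumF (λ j → μ′ j * h j i) ≈ 0#
      rel zero    = trans (expand zero) (firstCancels μ)
      rel (suc i) = begin
        sumF (λ j → μ′ j * h j (suc i))
          ≈⟨ expand (suc i) ⟩
        t * h p (suc i) + sumF (λ j → μ j * h (punchIn p j) (suc i))
          ≈⟨ +-comm _ _ ⟩
        sumF (λ j → μ j * h (punchIn p j) (suc i)) + t * h p (suc i)
          ≈⟨ +-congˡ (pivotTerm (h p (suc i))) ⟨
        sumF (λ j → μ j * h (punchIn p j) (suc i)) + sumF (λ j → μ j * ((- g j) * h p (suc i)))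
          ≈⟨ sumF-distrib-+ (λ j → μ j * h (punchIn p j) (suc i)) (λ j → μ j * ((- g j) * h p (suc i))) ⟨
        sumF (λ j → μ j * h (punchIn p j) (suc i) + μ j * ((- g j) * h p (suc i)))
          ≈⟨ sumF-cong (λ j → distribˡ (μ j) (h (punchIn p j) (suc i)) ((- g j) * h p (suc i))) ⟨
        sumF (λ j → μ j * reduced j i)
          ≈⟨ μ-rel i ⟩
        0# ∎

  pigeonhole-dependent : ∀ m (h : Fin (suc m) → Col m) → LinearlyDependent h
  pigeonhole-dependent zero    h = (λ _ → 1#) , (zero , λ 1≈0 → 0≉1 (sym 1≈0)) , λ ()
  pigeonhole-dependent (suc m) h with Finₚ.all? (λ j → decEq (h j zero) 0#)
  ... | yes firstRow≈0 = dependent-lift firstCancels (pigeonhole-dependent m reduced)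
    where
    open Elimination h zero 0ᶜ
    firstCancels : FirstCoordinateCancels
    firstCancels μ = trans (+-cong (trans (*-congˡ (firstRow≈0 zero)) (zeroʳ _))
                                   (sumF-zero (λ j → trans (*-congˡ (firstRow≈0 (suc j))) (zeroʳ (μ j)))))
                           (+-identityʳ 0#)
  ... | no ¬firstRow≈0 = dependent-lift firstCancels (pigeonhole-dependent m reduced)
    where
    pivot = Finₚ.¬∀⟶∃¬ _ (λ j → h j zero ≈ 0#) (λ j → decEq (h j zero) 0#) ¬firstRow≈0
    p = proj₁ pivot
    piv⁻¹ = proj₁ (inverse (h p zero) (proj₂ pivot))
    g = λ j → h (punchIn p j) zero * piv⁻¹
    open Elimination h p g
    firstCancels : FirstCoordinateCancels
    firstCancels μ = trans (+-congʳ tpiv≈-S) (-‿inverseˡ S)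
      where
      open SetoidReasoning setoid
      S = sumF (λ j → μ j * h (punchIn p j) zero)
      tpiv≈-S : (- sumF (λ j → μ j * g j)) * h p zero ≈ - S
      tpiv≈-S = begin
        (- sumF (λ j → μ j * g j)) * h p zero
          ≈⟨ *-congʳ (-‿cong (sumF-cong (λ j → *-assoc (μ j) (h (punchIn p j) zero) piv⁻¹))) ⟨
        (- sumF (λ j → (μ j * h (punchIn p j) zero) * piv⁻¹)) * h p zero
          ≈⟨ *-congʳ (-‿cong (*-distribʳ-sumF piv⁻¹ (λ j → μ j * h (punchIn p j) zero))) ⟨
        (- (S * piv⁻¹)) * h p zero               ≈⟨ *-congʳ (-‿distribˡ-* S piv⁻¹) ⟩
        ((- S) * piv⁻¹) * h p zero               ≈⟨ *-assoc (- S) piv⁻¹ _ ⟩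
        (- S) * (piv⁻¹ * h p zero)
          ≈⟨ *-congˡ (trans (*-comm piv⁻¹ _) (proj₂ (inverse (h p zero) (proj₂ pivot)))) ⟩
        (- S) * 1#                               ≈⟨ *-identityʳ (- S) ⟩
        - S                                      ∎

  -- Finiteness: deciding membership in a span

  allCols : ∀ n → List (Col n)
  allCols zero    = (λ ()) ∷ []
  allCols (suc n) = cartesianProductWith Vector._∷_ elements (allCols n)

  allCols-complete : ∀ n (v : Col n) → Any.Any (v ≋_) (allCols n)
  allCols-complete zero    v = Any.here (λ ())
  allCols-complete (suc n) v =
    cartesianProductWith⁺ Vector._∷_ cons≋ (complete (v zero)) (allCols-complete n (tail v))
    where
    cons≋ : ∀ {a u} → v zero ≈ a → tail v ≋ u → v ≋ a Vector.∷ u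
    cons≋ head≈ tail≋ zero    = head≈
    cons≋ head≈ tail≋ (suc i) = tail≋ i

  any?-Col : ∀ {n} {P : Col n → Set} → (∀ {u v} → u ≋ v → P u → P v) → (∀ u → Dec (P u)) → Dec (∃ P)
  any?-Col {n} resp P? with Any.any? P? (allCols n)
  ... | yes found = yes (Any.satisfied found)
  ... | no ¬found = no λ (u , Pu) → ¬found (Any.map (λ u≋v → resp u≋v Pu) (allCols-complete n u))

  all-or-counterexample-Col : ∀ {n} {P : Col n → Set} → (∀ {u v} → u ≋ v → P u → P v) → (∀ u → Dec (P u)) →
    (∀ u → P u) ⊎ ∃ (¬_ ∘ P)
  all-or-counterexample-Col {P = P} resp P?
    with any?-Col {P = ¬_ ∘ P} (λ u≋v ¬Pu Pv → ¬Pu (resp (≋-sym u≋v) Pv)) (¬? ∘ P?)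
  ... | yes counterexample = inj₂ counterexample
  ... | no ¬counterexample = inj₁ λ u → decidable-stable (P? u) (λ ¬Pu → ¬counterexample (u , ¬Pu))

  ≈ₛ-from-head-tail : ∀ {m} {x y : SElt m} → (∀ i → coeff x 0 i ≈ coeff y 0 i) → Tₛ x ≈ₛ Tₛ y → x ≈ₛ y
  ≈ₛ-from-head-tail {x = x} {y} head≈ tail≈ zero    i = head≈ i
  ≈ₛ-from-head-tail {x = x} {y} head≈ tail≈ (suc j) i =
    trans (sym (coeff-Tₛ x j i)) (trans (tail≈ j i) (coeff-Tₛ y j i))

  ≈ₛ-dec-step : ∀ {m} (x y : SElt m) → Dec (Tₛ x ≈ₛ Tₛ y) → Dec (x ≈ₛ y)
  ≈ₛ-dec-step x y tail? with Finₚ.all? (λ i → decEq (coeff x 0 i) (coeff y 0 i)) | tail?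
  ... | no ¬head≈ | _         = no λ x≈y → ¬head≈ (x≈y 0)
  ... | yes head≈ | yes tail≈ = yes (≈ₛ-from-head-tail {x = x} {y} head≈ tail≈)
  ... | yes _     | no ¬tail≈ = no λ x≈y → ¬tail≈ (coeff≈ (Tₛ-cong (mk≃ {x = x} {y} x≈y)))

  ≈ₛ-dec : ∀ {m} (x y : SElt m) → Dec (x ≈ₛ y)
  ≈ₛ-dec []       []       = yes (λ _ _ → refl)
  ≈ₛ-dec []       (b ∷ bs) = ≈ₛ-dec-step [] (b ∷ bs) (≈ₛ-dec [] bs)
  ≈ₛ-dec (a ∷ as) []       = ≈ₛ-dec-step (a ∷ as) [] (≈ₛ-dec as [])
  ≈ₛ-dec (a ∷ as) (b ∷ bs) = ≈ₛ-dec-step (a ∷ as) (b ∷ bs) (≈ₛ-dec as bs)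

  InSpan-resp : ∀ {m n} {ν : Fin n → SElt m} {i} {x y : SElt m} → x ≃ y → InSpan i ν x → InSpan i ν y
  InSpan-resp {ν = ν} {y = y} x≃y (c , c-supp , x≈) =
    c , c-supp , coeff≈ (≃-trans (≃-sym x≃y) (mk≃ {y = lin c ν} x≈))

  InSpan-dec : ∀ {m n} (ν : Fin n → SElt m) x → Dec (InSpan n ν x)
  InSpan-dec {n = n} ν x
    with any?-Col {P = λ c → x ≈ₛ lin c ν}
           (λ {c} {d} c≋d x≈c → coeff≈ (≃-trans (mk≃ {x = x} {lin c ν} x≈c) (lin-congˡ {c = c} {d} ν c≋d)))
           (λ c → ≈ₛ-dec x (lin c ν))
  ... | yes (c , x≈c) = yes (c , suppBelow-all c , x≈c)
  ... | no ¬spanned   = no λ (c , _ , x≈c) → ¬spanned (c , x≈c)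

  -- Existence of children with a prescribed T-image

  Tₛ-kernel : ∀ {m} {x : SElt m} → Tₛ x ≃ 0ₛ → x ≃ (coeff x 0 ∷ [])
  Tₛ-kernel {x = x} (mk≃ Tx≈0) = mk≃ λ { zero i → refl ; (suc j) i → trans (sym (coeff-Tₛ x j i)) (Tx≈0 j i) }

  lin-constants : ∀ {m p} (μ : Col p) (h : Fin p → Col m) →
    lin μ (λ j → h j ∷ []) ≃ ((λ i → sumF (λ j → μ j * h j i)) ∷ [])
  lin-constants μ h = mk≃ λ
    { zero    i → coeff-lin μ (λ j → h j ∷ []) zero i
    ; (suc k) i → trans (coeff-lin μ (λ j → h j ∷ []) (suc k) i) (sumF-zero (λ j → zeroʳ (μ j))) }

  -- T has an m-dimensional kernel on S^m, so a flag cannot carry m + 1 independent T-killed vectors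
  kernel-dimension-bound : ∀ {m p} {ν′ : Fin p → SElt m} {N′ : Mat p p} → IsFlag ν′ → IsMatrixOfT ν′ N′ →
    (W : Mat p (suc m)) → (∀ j → N′ ⊗ᵥ col W j ≋ 0ᶜ) → (∀ μ → W ⊗ᵥ μ ≋ 0ᶜ → μ ≋ 0ᶜ) → ⊥
  kernel-dimension-bound {m} {ν′ = ν′} {N′} ν′-flag N′-mat W W-kernel W-injective =
    μj₀≉0 (W-injective μ Wμ≋0 j₀)
    where
    z : Fin (suc m) → SElt m
    z j = lin (col W j) ν′
    h : Fin (suc m) → Col m
    h j = coeff (z j) 0
    z≃h : ∀ j → z j ≃ (h j ∷ [])
    z≃h j = Tₛ-kernel (≃-trans (Tₛ-lin-matrix {X = N′} N′-mat (col W j))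
                               (≃-trans (lin-congˡ ν′ (W-kernel j)) (lin-zero ν′)))
    dependence = pigeonhole-dependent m h
    μ = proj₁ dependence
    j₀ = proj₁ (proj₁ (proj₂ dependence))
    μj₀≉0 = proj₂ (proj₁ (proj₂ dependence))
    Wμ≋0 : W ⊗ᵥ μ ≋ 0ᶜ
    Wμ≋0 = ν′-flag (W ⊗ᵥ μ) (coeff≈ (begin
      lin (W ⊗ᵥ μ) ν′                                ≈⟨ lin-⊗ᵥ W μ ν′ ⟨
      lin μ z                                         ≈⟨ lin-congʳ μ z≃h ⟩
      lin μ (λ j → h j ∷ [])                          ≈⟨ lin-constants μ h ⟩
      (λ i → sumF (λ j → μ j * h j i)) ∷ []
        ≈⟨ mk≃ (λ { zero i → proj₂ (proj₂ dependence) i ; (suc _) _ → refl }) ⟩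
      0ₛ                                              ∎))
      where open SetoidReasoning (≃-setoid _)

  Conjugate-kernel : ∀ {p q} {X Y : Mat p p} (c : Conjugate X Y) {W : Mat p q} →
    (∀ j → X ⊗ᵥ col W j ≋ 0ᶜ) → (∀ μ → W ⊗ᵥ μ ≋ 0ᶜ → μ ≋ 0ᶜ) →
    (∀ j → Y ⊗ᵥ col (Conjugate.Q c ⊗ W) j ≋ 0ᶜ) × (∀ μ → (Conjugate.Q c ⊗ W) ⊗ᵥ μ ≋ 0ᶜ → μ ≋ 0ᶜ)
  Conjugate-kernel {X = X} {Y} c {W} W-kernel W-injective = QW-kernel , QW-injective
    where
    open Conjugate c
    QW-kernel : ∀ j → Y ⊗ᵥ (Q ⊗ᵥ col W j) ≋ 0ᶜ
    QW-kernel j i = trans (sym (⊗ᵥ-assoc Y Q (col W j) i)) (trans (⊗ᵥ-cong (≈ₘ.sym Q-intertwines) ≋-refl i)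
      (trans (⊗ᵥ-assoc Q X (col W j) i) (trans (⊗ᵥ-congʳ Q (W-kernel j) i) (⊗ᵥ-zeroʳ Q i))))
    QW-injective : ∀ μ → (Q ⊗ W) ⊗ᵥ μ ≋ 0ᶜ → μ ≋ 0ᶜ
    QW-injective μ QWμ≋0 = W-injective μ (⊗ᵥ≋0⇒≋0 P Q P⊗Q≈I (λ r → trans (sym (⊗ᵥ-assoc Q W μ r)) (QWμ≋0 r)))

  module _ {n} (N : Mat n n) (d v : Col n) (t : Carrier) where

    block-⊗ᵥ-extend-init : ∀ r → (block N d 0# ⊗ᵥ extend v t) (inject₁ r) ≈ (N ⊗ᵥ v) r + d r * t
    block-⊗ᵥ-extend-init r = trans (sumF-init-last (λ l → block N d 0# (inject₁ r) l * extend v t l))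
      (+-cong (sumF-cong (λ l → *-cong (block-init-init N d 0# r l) (extend-inject₁ v t l)))
              (*-cong (block-init-last N d 0# r) (extend-fromℕ v t)))

    block-⊗ᵥ-extend-last : (block N d 0# ⊗ᵥ extend v t) (fromℕ n) ≈ 0#
    block-⊗ᵥ-extend-last = trans (sumF-init-last (λ l → block N d 0# (fromℕ n) l * extend v t l))
      (trans (+-cong (sumF-zero (λ l → trans (*-congʳ (block-last-init N d 0# l)) (zeroˡ _)))
                     (trans (*-congʳ (block-last-last N d 0#)) (zeroˡ _)))
             (+-identityʳ 0#))

  -- if every e ∷ lin d ν lay in V, the coordinates of the T-kernel of S^m and of 0 ∷ lin d ν would give
  -- m + 1 independent vectors killed by ( N d ; 0 0 )
  module SpannedPreimages {m n} {ν : Fin n → SElt m} {N : Mat n n}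
    (ν-flag : IsFlag ν) (N-mat : IsMatrixOfT ν N) (d : Col n) (spanned : ∀ e → InSpan n ν (e ∷ lin d ν)) where

    coords : Col m → Col n
    coords e = proj₁ (spanned e)

    coords-≃ : ∀ e → (e ∷ lin d ν) ≃ lin (coords e) ν
    coords-≃ e = mk≃ (proj₂ (proj₂ (spanned e)))

    a : Col n
    a = coords 0ᶜ

    c : Fin m → Col n
    c j l = coords (unit j) l - a l

    unit≃ : ∀ j → (unit j ∷ []) ≃ lin (c j) ν
    unit≃ j = mk≃ λ k i → sym (trans (lin-sub (coords (unit j)) a ν k i)
      (trans (+-cong (sym (coeff≈ (coords-≃ (unit j)) k i)) (-‿cong (sym (coeff≈ (coords-≃ 0ᶜ) k i))))
             (difference k i)))
      where
      difference : ∀ k i → coeff (unit j ∷ lin d ν) k i - coeff (0ᶜ ∷ lin d ν) k i ≈ coeff (unit j ∷ []) k i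
      difference zero    i = trans (+-congˡ -0#≈0#) (+-identityʳ _)
      difference (suc k) i = -‿inverseʳ _

    N⊗c≋0 : ∀ j → N ⊗ᵥ c j ≋ 0ᶜ
    N⊗c≋0 j = lin-injective ν-flag
      (≃-trans (≃-sym (Tₛ-lin-matrix {X = N} N-mat (c j)))
               (≃-trans (Tₛ-cong (≃-sym (unit≃ j))) (≃-sym (lin-zero ν))))

    N⊗a≋d : N ⊗ᵥ a ≋ d
    N⊗a≋d =
      lin-injective ν-flag (≃-trans (≃-sym (Tₛ-lin-matrix {X = N} N-mat a)) (Tₛ-cong (≃-sym (coords-≃ 0ᶜ))))

    W : Mat (suc n) (suc m)
    W r zero    = extend (λ l → - a l) 1# r
    W r (suc j) = extend (c j) 0# r

    W-kernel : ∀ j → block N d 0# ⊗ᵥ col W j ≋ 0ᶜ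
    W-kernel zero r with initLast r
    ... | init r′ = trans (block-⊗ᵥ-extend-init N d (λ l → - a l) 1# r′)
        (trans (+-cong N⊗[-a]≈-d (*-identityʳ (d r′))) (-‿inverseˡ (d r′)))
      where
      N⊗[-a]≈-d : (N ⊗ᵥ (λ l → - a l)) r′ ≈ - d r′
      N⊗[-a]≈-d = trans (⊗ᵥ-congʳ N (λ l → sym (-1*x≈-x (a l))) r′)
        (trans (⊗ᵥ-* N (- 1#) a r′) (trans (-1*x≈-x _) (-‿cong (N⊗a≋d r′))))
    ... | last    = block-⊗ᵥ-extend-last N d (λ l → - a l) 1#
    W-kernel (suc j) r with initLast r
    ... | init r′ = trans (block-⊗ᵥ-extend-init N d (c j) 0# r′)
        (trans (+-cong (N⊗c≋0 j r′) (zeroʳ (d r′))) (+-identityʳ 0#))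
    ... | last    = block-⊗ᵥ-extend-last N d (c j) 0#

    module _ (μ : Col (suc m)) (Wμ≋0 : W ⊗ᵥ μ ≋ 0ᶜ) where

      μ₀≈0 : μ zero ≈ 0#
      μ₀≈0 = trans (sym lastRow) (Wμ≋0 (fromℕ n))
        where
        lastRow : (W ⊗ᵥ μ) (fromℕ n) ≈ μ zero
        lastRow = trans (+-cong (*-congʳ (extend-fromℕ (λ l → - a l) 1#))
                                (sumF-zero (λ j → trans (*-congʳ (extend-fromℕ (c j) 0#)) (zeroˡ _))))
                        (trans (+-identityʳ _) (*-identityˡ _))

      C : Mat n m
      C r j = c j r

      C⊗μ′≋0 : C ⊗ᵥ (μ ∘ suc) ≋ 0ᶜ
      C⊗μ′≋0 r = trans (sym topRow) (Wμ≋0 (inject₁ r))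
        where
        topRow : (W ⊗ᵥ μ) (inject₁ r) ≈ (C ⊗ᵥ (μ ∘ suc)) r
        topRow = trans (+-cong (trans (*-congˡ μ₀≈0) (zeroʳ _))
                               (sumF-cong (λ j → *-congʳ (extend-inject₁ (c j) 0# r))))
                       (+-identityˡ _)

      μ′≈0 : ∀ i → μ (suc i) ≈ 0#
      μ′≈0 i = begin
        μ (suc i)                                        ≈⟨ trans (*-congˡ (I-diag i)) (*-identityʳ _) ⟨
        μ (suc i) * I i i                                ≈⟨ sumF-δ (λ j → μ (suc j) * I i j) i off ⟨
        sumF (λ j → μ (suc j) * I i j)                   ≈⟨ coeff≈ (lin-constants (μ ∘ suc) unit) zero i ⟨
        coeff (lin (μ ∘ suc) (λ j → unit j ∷ [])) 0 i    ≈⟨ coeff≈ (lin-congʳ (μ ∘ suc) unit≃) zero i ⟩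
        coeff (lin (μ ∘ suc) (λ j → lin (c j) ν)) 0 i    ≈⟨ coeff≈ (lin-⊗ᵥ C (μ ∘ suc) ν) zero i ⟩
        coeff (lin (C ⊗ᵥ (μ ∘ suc)) ν) 0 i
          ≈⟨ coeff≈ (≃-trans (lin-congˡ ν C⊗μ′≋0) (lin-zero ν)) zero i ⟩
        0#                                               ∎
        where
        open SetoidReasoning setoid
        off : ∀ j → j ≢ i → μ (suc j) * I i j ≈ 0#
        off j j≢i = trans (*-congˡ (I-off (j≢i ∘ ≡.sym))) (zeroʳ _)

    W-injective : ∀ μ → W ⊗ᵥ μ ≋ 0ᶜ → μ ≋ 0ᶜ
    W-injective μ Wμ≋0 zero    = μ₀≈0 μ Wμ≋0
    W-injective μ Wμ≋0 (suc i) = μ′≈0 μ Wμ≋0 i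

  child-exists : ∀ {m n} {ν : Fin n → SElt m} {ν′ : Fin (suc n) → SElt m}
    {N : Mat n n} {N′ : Mat (suc n) (suc n)} →
    IsFlag ν → IsMatrixOfT ν N → IsFlag ν′ → IsMatrixOfT ν′ N′ →
    ∀ d → Conjugate (block N d 0#) N′ → ∃ λ x → ¬ InSpan n ν x × Tₛ x ≃ lin d ν
  child-exists {m} {n} {ν} {ν′} {N} {N′} ν-flag N-mat ν′-flag N′-mat d conj
    with all-or-counterexample-Col {P = λ e → InSpan n ν (e ∷ lin d ν)}
           (λ {e} {e′} e≋e′ → InSpan-resp {ν = ν}
              (mk≃ {x = e ∷ lin d ν} {e′ ∷ lin d ν} λ { zero i → e≋e′ i ; (suc _) _ → refl }))
           (λ e → InSpan-dec ν (e ∷ lin d ν))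
  ... | inj₂ (e , e∉V) = (e ∷ lin d ν) , e∉V , ≃-refl
  ... | inj₁ spanned   =
    ⊥-elim (kernel-dimension-bound {ν′ = ν′} {N′} ν′-flag N′-mat (Conjugate.Q conj ⊗ W) (proj₁ QW) (proj₂ QW))
    where
    open SpannedPreimages {N = N} ν-flag N-mat d spanned
    QW = Conjugate-kernel conj {W = W} W-kernel W-injective

  -- The correspondence between M(V;[V′]) and B(N;[N′])

  MEquiv⇔ProportionalModImage : ∀ {m n} {ν : Fin n → SElt m} {N : Mat n n} → IsFlag ν → IsMatrixOfT ν N →
    ∀ {x y d d′} → Tₛ x ≃ lin d ν → Tₛ y ≃ lin d′ ν → MEquiv ν x y ⇔ ProportionalModImage N d d′
  MEquiv⇔ProportionalModImage {ν = ν} {N} ν-flag N-mat {x} {y} {d} {d′} Tx≃d Ty≃d′ = mk⇔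
    (λ (k , k≉0 , c , T[x-ky]≈Tc) → k , k≉0 , c ,
       lin-injective ν-flag
         (≃-trans (≃-sym (Tₛ-difference k)) (≃-trans (mk≃ T[x-ky]≈Tc) (Tₛ-lin-matrix {X = N} N-mat c))))
    (λ (k , k≉0 , c , d-kd′≋Nc) → k , k≉0 , c ,
       coeff≈ (≃-trans (Tₛ-difference k)
                (≃-trans (lin-congˡ ν d-kd′≋Nc) (≃-sym (Tₛ-lin-matrix {X = N} N-mat c)))))
    where
    Tₛ-difference : ∀ k → Tₛ (x ⊕ ((- k) ·ₛ y)) ≃ lin (λ i → d i + (- k) * d′ i) ν
    Tₛ-difference k = ≃-trans (Tₛ-⊕ x _) (≃-trans (⊕-cong Tx≃d (≃-trans (Tₛ-·ₛ (- k) y) (·ₛ-cong refl Ty≃d′)))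
      (≃-sym (≃-trans (lin-+ d (λ i → (- k) * d′ i) ν) (⊕-cong ≃-refl (lin-* (- k) d′ ν)))))

  BOrbit-resp : ∀ {n} (N : Mat n n) {b₁ b₂ b₁′ b₂′ : Col n} → b₁ ≋ b₂ → b₁′ ≋ b₂′ →
    BOrbit N b₁ b₁′ → BOrbit N b₂ b₂′
  BOrbit-resp N b₁≋b₂ b₁′≋b₂′ = ProportionalModImage⇒BOrbit N
    ∘ ProportionalModImage-resp N b₁≋b₂ b₁′≋b₂′ ∘ BOrbit⇒ProportionalModImage N

  BOrbit-respects : ∀ {n} (N : Mat n n) → BOrbit N Respects₂ _≋_
  BOrbit-respects N = BOrbit-resp N ≋-refl , λ b≋b′ → BOrbit-resp N b≋b′ ≋-refl

  Col-setoid : ℕ → Setoid _ _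
  Col-setoid = ≋-setoid

  module Correspondence {m n} {ν′ : Fin (suc n) → SElt m} {N′ : Mat (suc n) (suc n)}
    (ν′-torsionFlag : IsTorsionFlag ν′) (N′-mat : IsMatrixOfT ν′ N′)
    {ν : Fin n → SElt m} (ν-torsionFlag : IsTorsionFlag ν) (ν≅parent : Iso ν (parent ν′)) where

    private
      ν-flag = proj₁ ν-torsionFlag
      ν′-flag = proj₁ ν′-torsionFlag
      N = proj₁ (torsion-matrix {ν = ν} (proj₂ ν-torsionFlag))
      N-mat = proj₁ (proj₂ (torsion-matrix {ν = ν} (proj₂ ν-torsionFlag)))
      N₀ = topLeft N′

      parentConj : Conjugate N N₀
      parentConj = Iso⇒Conjugate {X = N} ν-flag (parent-isFlag {ν′ = ν′} ν′-flag) N-mat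
                     (parent-matrix {ν′ = ν′} {N′} ν′-torsionFlag N′-mat) ν≅parent

      open Conjugate parentConj using ()
        renaming (P to R; Q to R′; P⊗Q≈I to R⊗R′≈I; Q⊗P≈I to R′⊗R≈I; Q-intertwines to R′-intertwines)
      open Conjugate (Conjugate-sym parentConj) using () renaming (Q-intertwines to R-intertwines)

      childConj : ∀ {x d} → ¬ InSpan n ν x → Tₛ x ≃ lin d ν →
        Iso (snoc ν x) ν′ ⇔ Conjugate (block N d 0#) N′
      childConj {x} {d} x∉V Tx≃d = mk⇔
        (Iso⇒Conjugate {ν = snoc ν x} {ν′} {block N d 0#} {N′} snocν-flag ν′-flag snocν-mat N′-mat)
        (Conjugate⇒Iso {ν = snoc ν x} {ν′} {block N d 0#} {N′} snocν-flag ν′-flag snocν-mat N′-mat)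
        where
        snocν-flag = snoc-isFlag {ν = ν} {x} ν-flag x∉V
        snocν-mat = snoc-matrix {ν = ν} {x} {N} {d} N-mat Tx≃d

    image : ∀ {x} → MSet ν ν′ x → Col n
    image (_ , (d , _ , _) , _) = R′ ⊗ᵥ d

    image-inBSet : ∀ {x} (x∈M : MSet ν ν′ x) → BSet N₀ N′ (image x∈M)
    image-inBSet (x∉V , (d , _ , Tx≈d) , snocν≅ν′) = Conjugate⇒InConjClass
      (Conjugate-trans (Conjugate-sym (Conjugate-block parentConj d))
                       (Equivalence.to (childConj x∉V (mk≃ Tx≈d)) snocν≅ν′))

    lift : ∀ b → BSet N₀ N′ b → Σ (SElt m) λ x → Σ (MSet ν ν′ x) λ x∈M → image x∈M ≋ b
    lift b b∈B =
      x , (x∉V , (R ⊗ᵥ b , suppBelow-all (R ⊗ᵥ b) , coeff≈ Tx≃Rb) , Equivalence.from (childConj x∉V Tx≃Rb) conj) ,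
      ⊗ᵥ-cancel R′ R R′⊗R≈I b
      where
      conj : Conjugate (block N (R ⊗ᵥ b) 0#) N′
      conj = Conjugate-trans (Conjugate-sym (Conjugate-block (Conjugate-sym parentConj) b))
                             (InConjClass⇒Conjugate b∈B)
      child = child-exists {ν′ = ν′} {N} {N′} ν-flag N-mat ν′-flag N′-mat (R ⊗ᵥ b) conj
      x = proj₁ child
      x∉V = proj₁ (proj₂ child)
      Tx≃Rb = proj₂ (proj₂ child)

    MEquiv⇔BOrbit : ∀ {x y} (x∈M : MSet ν ν′ x) (y∈M : MSet ν ν′ y) →
      MEquiv ν x y ⇔ BOrbit N₀ (image x∈M) (image y∈M)
    MEquiv⇔BOrbit {x} {y} (_ , (d , _ , Tx≈d) , _) (_ , (d′ , _ , Ty≈d′) , _) = mk⇔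
      (ProportionalModImage⇒BOrbit N₀ ∘ ProportionalModImage-map R′-intertwines ∘ Equivalence.to equiv)
      (Equivalence.from equiv ∘ ProportionalModImage-resp N (⊗ᵥ-cancel R R′ R⊗R′≈I d) (⊗ᵥ-cancel R R′ R⊗R′≈I d′)
        ∘ ProportionalModImage-map R-intertwines ∘ BOrbit⇒ProportionalModImage N₀)
      where
      equiv = MEquiv⇔ProportionalModImage {ν = ν} {N} ν-flag N-mat {x} {y} {d} {d′}
                (mk≃ {x = Tₛ x} {lin d ν} Tx≈d) (mk≃ {x = Tₛ y} {lin d′ ν} Ty≈d′)

proposition3p10 : (𝔽 : FiniteField) → let open Over 𝔽 in
    (m n : ℕ) → 2 ≤ m → 1 ≤ n →
    -- a representative V' of the (n+1)-flag class [V'], by an ordered basis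
    (ν′ : Fin (suc n) → SElt m) → IsTorsionFlag ν′ →
    -- N' is the matrix of T on that ordered basis, so [N'] corresponds to [V']
    (N′ : Mat (suc n) (suc n)) → IsMatrixOfT ν′ N′ →
    -- any representative V of the parent class of [V']
    (ν : Fin n → SElt m) → IsTorsionFlag ν → Iso ν (parent ν′) →
    -- matrix degree of [V'] = matrix degree of [N']
    (k : ℕ) →
    HasClasses (MSet ν ν′) (MEquiv ν) k ⇔ HasClasses (BSet (topLeft N′) N′) (BOrbit (topLeft N′)) k
proposition3p10 𝔽 m n _ _ ν′ ν′-torsionFlag N′ N′-mat ν ν-torsionFlag ν≅parent =
  HasClasses-transfer (Col-setoid 𝔽 n) (BOrbit-respects 𝔽 (Over.topLeft 𝔽 N′))
    (λ _ → image) (λ _ → image-inBSet) lift MEquiv⇔BOrbit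
  where
  open Correspondence 𝔽 {ν′ = ν′} {N′} ν′-torsionFlag N′-mat {ν} ν-torsionFlag ν≅parent
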